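{- Let $X\in\{A,B,D\}$ and let $w\in S^X_n$ (where $S^A_n=S_n$). Then \[ \$(w)=\frac{\operatorname{tvd}(w)}{2}+\operatorname{bl}^B(w)-\operatorname{bl}^X(w). \]
   Context: Fix a positive integer $n$, $[n]=\{1,\dots,n\}$, $\pm[n]=\{\pm1,\dots,\pm n\}$. $S^A_n=S_n$ is the group of bijections of $[n]$, regarded also as the subgroup of $S^B_n$ of elements preserving $[n]$. $S^B_n$ is the group of bijections $w$ of $\pm[n]$ with $w(-i)=-w(i)$; $S^D_n$ is the subgroup of $w\in S^B_n$ with $\#\{i\in[n]:w(i)<0\}$ even. The total displacement is $\operatorname{tvd}(w)=\sum_{i=1}^n|w(i)-i|$. Transpositions of $S^X_n$: in $S_n$, the usual transpositions $(i~j)$; in $S^B_n$, the involutions $(i~j)(-i~-j)$ for $j\ne\pm i$ and $(i~-i)$; in $S^D_n$, only the involutions $(i~j)(-i~-j)$ with $j\ne \pm i$. The cost of a transposition $t$ is $\$(t)=\operatorname{tvd}(t)/2$ (so $\$((i~j)(-i~-j))=|i-j|$, $\$((i~-i))=|i|$), and for $w\in S^X_n$, $\$(w)=\min\{\$(t_1)+\cdots+\$(t_k): t_i\text{ transpositions of } S^X_n,\ t_1\cdots t_k=w\}$ (identity has cost $0$). Blocks: every signed permutation decomposes uniquely as a direct sum of indecomposable signed permutations; equivalently, $\operatorname{bl}^B(w)$ is the number of $j\in[n]$ such that $w$ restricts to a bijection of $\pm[j]$ onto itself. $\operatorname{bl}^A(w)$ for $w\in S_n$ is the number of $j\in[n]$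 with $w([j])=[j]$ (which equals $\operatorname{bl}^B(w)$). For $w\in S^D_n$, $\operatorname{bl}^D(w)$ is the number of summands in the finest decomposition of $w$ as a direct sum of even-signed permutations, i.e., the number of $j\in[n]$ such that $w$ restricts to a bijection of $\pm[j]$ onto itself and $\#\{i\in[j]: w(i)<0\}$ is even. -}

module Defs where

open import Data.Nat using (ℕ; zero; suc; _+_; _*_; _<ᵇ_; _≡ᵇ_; _≤_; ∣_-_∣)
open import Data.Integer as ℤ using (ℤ; +_)
open import Data.Fin using (Fin; toℕ)
open import Data.Bool using (Bool; true; false; _xor_; if_then_else_; _∧_; not; T)
open import Data.List using (List; []; _∷_; map; allFin; filter; length; upTo)
open import Data.Nat.ListAction using (sum)
open import Data.Bool.ListAction using (all; any)
open import Data.Product using (Σ; _×_; _,_)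
open import Data.Unit using (⊤)
open import Relation.Binary.PropositionalEquality using (_≡_; _≢_)
open import Relation.Nullary.Decidable using (T?)

data Kind : Set where
  A B D : Kind

-- A (candidate) signed permutation w of ±[n], 0-indexed internally:
-- for i : Fin n (standing for the integer toℕ i + 1),
--   w(toℕ i + 1) = (if neg i then -1 else +1) * (toℕ (perm i) + 1),
-- and w(-x) = -w(x).  It is a genuine signed permutation iff perm is injective.
record SPerm (n : ℕ) : Set where
  constructor sp
  field
    perm : Fin n → Fin n
    neg  : Fin n → Bool
open SPerm public

val : ∀ {n} → SPerm n → Fin n → ℤ
val w i = if neg w i then ℤ.- (+ suc (toℕ (perm w i))) else + suc (toℕ (perm w i))

_≈_ : ∀ {n} → SPerm n → SPerm n → Set
u ≈ v = ∀ i → val u i ≡ val v i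

idSP : ∀ {n} → SPerm n
idSP = sp (λ i → i) (λ _ → false)

-- composition u ∘ v (first v, then u)
_∘SP_ : ∀ {n} → SPerm n → SPerm n → SPerm n
u ∘SP v = sp (λ i → perm u (perm v i)) (λ i → neg v i xor neg u (perm v i))

swapFin : ∀ {n} → Fin n → Fin n → Fin n → Fin n
swapFin {n} i j k =
  if toℕ k ≡ᵇ toℕ i then j else (if toℕ k ≡ᵇ toℕ j then i else k)

-- Transpositions of S^X_n.
--   pos i j : (i j)(-i -j)             (i ≠ j, both positive)
--   ngt i j : (i -j)(-i j)             (i ≠ j), i.e. (i j')(-i -j') with j' = -j; not in type A
--   flp i   : (i -i)                   only in type B
data Trans : Kind → ℕ → Set where
  pos : ∀ {X n} (i j : Fin n) → i ≢ j → Trans X n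
  ngt : ∀ {X n} → X ≢ A → (i j : Fin n) → i ≢ j → Trans X n
  flp : ∀ {n} (i : Fin n) → Trans B n

⟦_⟧ : ∀ {X n} → Trans X n → SPerm n
⟦ pos i j _ ⟧ = sp (swapFin i j) (λ _ → false)
⟦ ngt _ i j _ ⟧ = sp (swapFin i j) (λ k → (toℕ k ≡ᵇ toℕ i) Data.Bool.∨ (toℕ k ≡ᵇ toℕ j))
⟦ flp i ⟧ = sp (λ k → k) (λ k → toℕ k ≡ᵇ toℕ i)

tvd : ∀ {n} → SPerm n → ℕ
tvd {n} w = sum (map (λ i → ℤ.∣ val w i ℤ.- (+ suc (toℕ i)) ∣) (allFin n))

-- cost $(t) = tvd(t)/2
tcost : ∀ {X n} → Trans X n → ℕ
tcost (pos i j _) = ∣ toℕ i - toℕ j ∣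
tcost (ngt _ i j _) = suc (toℕ i) + suc (toℕ j) -- |i - (-j)|
tcost (flp i) = suc (toℕ i)

prod : ∀ {X n} → List (Trans X n) → SPerm n
prod [] = idSP
prod (t ∷ ts) = ⟦ t ⟧ ∘SP prod ts

totalCost : ∀ {X n} → List (Trans X n) → ℕ
totalCost ts = sum (map tcost ts)

IsMinCost : ∀ {n} (X : Kind) → SPerm n → ℕ → Set
IsMinCost {n} X w c =
  Σ (List (Trans X n)) (λ ts → (prod ts ≈ w) × (totalCost ts ≡ c))
  × (∀ (ts : List (Trans X n)) → prod ts ≈ w → c ≤ totalCost ts)

even : ℕ → Bool
even zero = true
even (suc k) = not (even k)

negCountUpTo : ∀ {n} → SPerm n → ℕ → ℕ
negCountUpTo {n} w j = length (filter (λ i → T? (neg w i ∧ (toℕ i <ᵇ j))) (allFin n))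

InGroup : ∀ {n} → Kind → SPerm n → Set
InGroup A w = ∀ i → neg w i ≡ false
InGroup B w = ⊤
InGroup {n} D w = even (negCountUpTo w n) ≡ true

-- w restricts to a bijection of ±[j] onto itself (j a natural number; [j] = {1..j}):
-- every i ∈ [j] has |w(i)| ∈ [j], and every k ∈ [j] equals |w(i)| for some i ∈ [j].
-- (Signs are irrelevant since w(-i) = -w(i).)
closedB : ∀ {n} → SPerm n → ℕ → Bool
closedB {n} w j =
  all (λ i → not (toℕ i <ᵇ j) Data.Bool.∨ (toℕ (perm w i) <ᵇ j)) (allFin n)
  ∧ all (λ k → not (toℕ k <ᵇ j) Data.Bool.∨
                 any (λ i → (toℕ i <ᵇ j) ∧ (toℕ (perm w i) ≡ᵇ toℕ k)) (allFin n))
        (allFin n)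

range1 : ℕ → List ℕ
range1 n = map suc (upTo n)

blB : ∀ {n} → SPerm n → ℕ
blB {n} w = length (filter (λ j → T? (closedB w j)) (range1 n))

-- bl^A(w) for w ∈ S_n: #{j ∈ [n] : w([j]) = [j]}  (same test, w has no signs)
blA : ∀ {n} → SPerm n → ℕ
blA {n} w = length (filter (λ j → T? (closedB w j)) (range1 n))

blD : ∀ {n} → SPerm n → ℕ
blD {n} w = length (filter (λ j → T? (closedB w j ∧ even (negCountUpTo w j))) (range1 n))

bl : ∀ {n} → Kind → SPerm n → ℕ
bl A w = blA w
bl B w = blB w
bl D w = blD w

{-# OPTIONS --safe #-}
-- Cut the line at the points ±(k+½), 0 ≤ k < n.  The displacement tvd(w) counts, over all
-- cuts, the cut points crossed by the entries i ↦ w(i), and a transposition t crosses 2$(t) of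
-- them.  In type D a cut that closes a block with an odd number of negative entries is charged
-- 2 more.  The resulting potential equals tvd(w) + 2(bl^B(w) − bl^X(w)), vanishes at the
-- identity, and changes by at most 2$(t) when w is multiplied by t, since at each cut only the
-- two entries moved by t change.  Conversely, letting i be the largest position that w moves,
-- a suitable transposition involving the value at i lowers the potential by exactly 2$(t) and
-- stays in S^X_n; by induction the potential is exactly 2$(w).

module Submission where

open import Defs
open import Data.Bool.ListAction using (all; any)
import Data.Bool as Bool
open import Data.Bool using (Bool; true; false; T; not; _∧_; _∨_; _xor_) renaming (_≤_ to _⊑_)
open import Data.Bool.Properties
  using (T-∧; T-≡; ¬-not; not-involutive; not-injective; ∧-identityʳ; ∧-zeroʳ; ∨-zeroʳ; xor-assoc; xor-same; xor-comm; xor-identityʳ)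
  renaming (≤-reflexive to ⊑-reflexive; ≤-minimum to ⊑-minimum)
open import Data.Empty using (⊥; ⊥-elim)
open import Data.Fin as Fin using (Fin; toℕ; fromℕ<; inject₁; punchIn; punchOut) renaming (zero to fzero; suc to fsuc)
open import Data.Fin.Permutation using (permutation)
open import Data.Fin.Properties
  using (toℕ-injective; toℕ<n; toℕ-fromℕ; toℕ-fromℕ<; toℕ-inject₁; punchInᵢ≢i; punchOut-injective; pigeonhole; any?)
open import Data.Integer as ℤ using (_⊖_)
import Data.Integer.Properties as ℤ
open import Data.List using (List; []; _∷_; tabulate; applyUpTo; filter; length; map)
open import Data.List.Properties using (map-tabulate; map-applyUpTo)
open import Data.Nat.ListAction using () renaming (sum to sumᴸ)
open import Data.Nat
  using (ℕ; zero; suc; pred; _+_; _*_; ∣_-_∣; _≤_; _<_; z≤n; s≤s; s≤s⁻¹; ≢-nonZero; _≟_; _<?_; _≤?_; _<ᵇ_; _≡ᵇ_; _≤ᵇ_)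
open import Data.Nat.Properties
open import Data.Product using (Σ; ∃; ∃₂; _×_; _,_; proj₁; proj₂)
open import Data.Sum using (_⊎_; inj₁; inj₂)
open import Data.Unit using (tt)
open import Data.Vec.Functional using (removeAt)
open import Data.Nat.Tactic.RingSolver using (solve-∀)
open import Data.Nat.Induction using (<-wellFounded)
open import Induction.WellFounded using (Acc; acc)
open import Function using (_∘_; id)
open import Function.Bundles using (Equivalence)
open import Function.Definitions using (Injective)
open import Relation.Binary.PropositionalEquality
open import Relation.Nullary using (¬_; yes; no)
open import Relation.Nullary.Decidable using (T?; ¬?; _×-dec_; _⊎-dec_; decidable-stable)
open import Relation.Unary using (Decidable)

open import Algebra.Properties.CommutativeMonoid.Sum +-0-commutativeMonoid
  using (sum; sum-syntax; sum-cong-≗; sum-replicate-zero; ∑-distrib-+; ∑-comm; sum-remove; sum-init-last; ∑-permute)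
open import Algebra.Properties.Semiring.Sum +-*-semiring using (*-distribˡ-sum)

𝟙 : Bool → ℕ
𝟙 true  = 1
𝟙 false = 0

𝟙≤1 : ∀ b → 𝟙 b ≤ 1
𝟙≤1 true  = ≤-refl
𝟙≤1 false = z≤n

𝟙-mono : ∀ {a b} → (a ≡ true → b ≡ true) → 𝟙 a ≤ 𝟙 b
𝟙-mono {false} _   = z≤n
𝟙-mono {true}  a⇒b rewrite a⇒b refl = ≤-refl

𝟙-injective : ∀ {a b} → 𝟙 a ≡ 𝟙 b → a ≡ b
𝟙-injective {false} {false} _ = refl
𝟙-injective {true}  {true}  _ = refl

𝟙-split : ∀ c e → 𝟙 c ≡ 𝟙 (c ∧ e) + 𝟙 (c ∧ not e)
𝟙-split true  true  = refl
𝟙-split true  false = refl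
𝟙-split false _     = refl

-- A row: h hypotheses a ⊑ b between Booleans and a conclusion m ≤ n.
Sequent : ℕ → Set
Sequent zero    = ℕ × ℕ
Sequent (suc h) = (Bool × Bool) × Sequent h

Holds : ∀ h → Sequent h → Set
Holds zero    σ = proj₁ σ ≤ proj₂ σ
Holds (suc h) σ = proj₁ (proj₁ σ) ⊑ proj₂ (proj₁ σ) → Holds h (proj₂ σ)

holds? : ∀ h → Sequent h → Bool
holds? zero    σ = proj₁ σ ≤ᵇ proj₂ σ
holds? (suc h) σ = (proj₁ (proj₁ σ) ∧ not (proj₂ (proj₁ σ))) ∨ holds? h (proj₂ σ)

holds?-sound : ∀ h σ → T (holds? h σ) → Holds h σ
holds?-sound zero    σ                  t    = ≤ᵇ⇒≤ _ _ t
holds?-sound (suc h) ((true  , true) , σ) t _ = holds?-sound h σ t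
holds?-sound (suc h) ((false , _)    , σ) t _ = holds?-sound h σ t

Table : ℕ → ℕ → Set
Table h zero    = Sequent h
Table h (suc k) = Bool → Table h k

Valid : ∀ h k → Table h k → Set
Valid h zero    σ = Holds h σ
Valid h (suc k) f = ∀ b → Valid h k (f b)

valid? : ∀ h k → Table h k → Bool
valid? h zero    σ = holds? h σ
valid? h (suc k) f = valid? h k (f true) ∧ valid? h k (f false)

-- The table is an implicit argument so that it is read off the expected type.
truth-table : ∀ h k {f : Table h k} → T (valid? h k f) → Valid h k f
truth-table h zero    {σ} t       = holds?-sound h σ t
truth-table h (suc k) {f} t true  = truth-table h k (proj₁ (Equivalence.to T-∧ t))
truth-table h (suc k) {f} t false = truth-table h k (proj₂ (Equivalence.to T-∧ t))

true≢false : true ≢ false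
true≢false ()

∧-true⁻ : ∀ {a b} → (a ∧ b) ≡ true → a ≡ true × b ≡ true
∧-true⁻ {true} {true} _ = refl , refl

⇒ᵇ-elim : ∀ {a b} → (not a ∨ b) ≡ true → a ≡ true → b ≡ true
⇒ᵇ-elim a⇒b refl = a⇒b

⇒ᵇ-intro : ∀ {a b} → (a ≡ true → b ≡ true) → (not a ∨ b) ≡ true
⇒ᵇ-intro {false} _   = refl
⇒ᵇ-intro {true}  a⇒b = a⇒b refl

≡-by-⇔ : ∀ {a b} → (a ≡ true → b ≡ true) → (b ≡ true → a ≡ true) → a ≡ b
≡-by-⇔ {false} {false} _ _ = refl
≡-by-⇔ {false} {true}  _ b⇒a = b⇒a refl
≡-by-⇔ {true}  a⇒b _ = sym (a⇒b refl)

<ᵇ-true : ∀ {m n} → m < n → (m <ᵇ n) ≡ true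
<ᵇ-true m<n = Equivalence.to T-≡ (<⇒<ᵇ m<n)

<ᵇ-true⁻¹ : ∀ {m n} → (m <ᵇ n) ≡ true → m < n
<ᵇ-true⁻¹ e = <ᵇ⇒< _ _ (Equivalence.from T-≡ e)

<ᵇ-false : ∀ {m n} → n ≤ m → (m <ᵇ n) ≡ false
<ᵇ-false n≤m = ¬-not (λ e → <⇒≱ (<ᵇ-true⁻¹ e) n≤m)

<ᵇ-false⁻¹ : ∀ {m n} → (m <ᵇ n) ≡ false → n ≤ m
<ᵇ-false⁻¹ e = ≮⇒≥ (λ m<n → true≢false (trans (sym (<ᵇ-true m<n)) e))

<ᵇ-antitone : ∀ {m n} k → m ≤ n → (n <ᵇ k) ⊑ (m <ᵇ k)
<ᵇ-antitone {m} {n} k m≤n with n <ᵇ k in e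
... | true  = ⊑-reflexive (sym (<ᵇ-true {n = k} (≤-<-trans m≤n (<ᵇ-true⁻¹ e))))
... | false = ⊑-minimum _

≡ᵇ-refl : ∀ m → (m ≡ᵇ m) ≡ true
≡ᵇ-refl m = Equivalence.to T-≡ (≡⇒≡ᵇ m m refl)

≡ᵇ-true⁻¹ : ∀ {m n} → (m ≡ᵇ n) ≡ true → m ≡ n
≡ᵇ-true⁻¹ e = ≡ᵇ⇒≡ _ _ (Equivalence.from T-≡ e)

≡ᵇ-false : ∀ {m n} → m ≢ n → (m ≡ᵇ n) ≡ false
≡ᵇ-false m≢n = ¬-not (m≢n ∘ ≡ᵇ-true⁻¹)

∑-mono-≤ : ∀ {n} {f g : Fin n → ℕ} → (∀ i → f i ≤ g i) → sum f ≤ sum g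
∑-mono-≤ {zero}  _   = z≤n
∑-mono-≤ {suc n} f≤g = +-mono-≤ (f≤g fzero) (∑-mono-≤ (f≤g ∘ fsuc))

∑-mono-≤-≡ : ∀ {n} {f g : Fin n → ℕ} → (∀ i → f i ≤ g i) → sum f ≡ sum g → ∀ i → f i ≡ g i
∑-mono-≤-≡ {suc n} {f} {g} f≤g ∑f≡∑g = pointwise
  where
  head≡ : f fzero ≡ g fzero
  head≡ = ≤-antisym (f≤g fzero) (+-cancelʳ-≤ _ _ _ (begin
    g fzero + sum (f ∘ fsuc) ≤⟨ +-monoʳ-≤ (g fzero) (∑-mono-≤ (f≤g ∘ fsuc)) ⟩
    g fzero + sum (g ∘ fsuc) ≡⟨ sym ∑f≡∑g ⟩
    f fzero + sum (f ∘ fsuc) ∎))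
    where open ≤-Reasoning
  pointwise : ∀ i → f i ≡ g i
  pointwise fzero    = head≡
  pointwise (fsuc i) = ∑-mono-≤-≡ (f≤g ∘ fsuc) (+-cancelˡ-≡ _ _ _ (trans (cong (_+ _) (sym head≡)) ∑f≡∑g)) i

∑-zero : ∀ {n} {f : Fin n → ℕ} → (∀ i → f i ≡ 0) → sum f ≡ 0
∑-zero {n} f≡0 = trans (sum-cong-≗ f≡0) (sum-replicate-zero n)

∑-double : ∀ {n} (f : Fin n → ℕ) → ∑[ i < n ] (2 * f i) ≡ 2 * sum f
∑-double f = sym (*-distribˡ-sum 2 f)

+-swap-ends : ∀ a r b → a + r + b ≡ b + r + a
+-swap-ends = solve-∀

+-swap-last : ∀ a b c → a + b + c ≡ a + c + b
+-swap-last = solve-∀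

∑-update : ∀ {n} (f g : Fin n → ℕ) p → (∀ x → x ≢ p → f x ≡ g x) → sum f + g p ≡ sum g + f p
∑-update {suc n} f g p agree = begin
  sum f + g p                        ≡⟨ cong (_+ g p) (sum-remove {i = p} f) ⟩
  f p + sum (removeAt f p) + g p     ≡⟨ cong (λ r → f p + r + g p) (sum-cong-≗ (λ j → agree (punchIn p j) (punchInᵢ≢i p j))) ⟩
  f p + sum (removeAt g p) + g p     ≡⟨ +-swap-ends (f p) _ (g p) ⟩
  g p + sum (removeAt g p) + f p     ≡⟨ cong (_+ f p) (sym (sum-remove {i = p} g)) ⟩
  sum g + f p                        ∎
  where open ≡-Reasoning

∑-single : ∀ {n} {f : Fin n → ℕ} p → (∀ x → x ≢ p → f x ≡ 0) → sum f ≡ f p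
∑-single {n} {f} p zero-elsewhere =
  trans (sym (+-identityʳ _)) (trans (∑-update f (λ _ → 0) p zero-elsewhere) (cong (_+ f p) (sum-replicate-zero n)))

∑-update₂ : ∀ {n} (f g : Fin n → ℕ) {p q} → p ≢ q → (∀ x → x ≢ p → x ≢ q → f x ≡ g x) →
            sum f + g p + g q ≡ sum g + f p + f q
∑-update₂ {n} f g {p} {q} p≢q agree = begin
  sum f + g p + g q  ≡⟨ cong (λ z → sum f + z + g q) (sym h-at-p) ⟩
  sum f + h p + g q  ≡⟨ cong (_+ g q) (∑-update f h p f≡h) ⟩
  sum h + f p + g q  ≡⟨ +-swap-last (sum h) (f p) (g q) ⟩
  sum h + g q + f p  ≡⟨ cong (_+ f p) (∑-update h g q h≡g) ⟩
  sum g + h q + f p  ≡⟨ +-swap-last (sum g) (h q) (f p) ⟩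
  sum g + f p + h q  ≡⟨ cong (sum g + f p +_) h-at-q ⟩
  sum g + f p + f q  ∎
  where
  open ≡-Reasoning
  h : Fin n → ℕ
  h x with x Fin.≟ p
  ... | yes _ = g x
  ... | no  _ = f x
  f≡h : ∀ x → x ≢ p → f x ≡ h x
  f≡h x x≢p with x Fin.≟ p
  ... | yes x≡p = ⊥-elim (x≢p x≡p)
  ... | no  _   = refl
  h≡g : ∀ x → x ≢ q → h x ≡ g x
  h≡g x x≢q with x Fin.≟ p
  ... | yes _   = refl
  ... | no  x≢p = agree x x≢p x≢q
  h-at-p : h p ≡ g p
  h-at-p with p Fin.≟ p
  ... | yes _   = refl
  ... | no  p≢p = ⊥-elim (p≢p refl)
  h-at-q : h q ≡ f q
  h-at-q = sym (f≡h q (p≢q ∘ sym))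

∑-≮ᵇ : ∀ {n X} → X < n → ∑[ k < n ] 𝟙 (not (X <ᵇ toℕ k)) ≡ suc X
∑-≮ᵇ {suc n} {zero}  _         = cong suc (sum-replicate-zero n)
∑-≮ᵇ {suc n} {suc X} (s≤s X<n) = cong suc (∑-≮ᵇ X<n)

∑-xor-<ᵇ : ∀ {n X Y} → X < n → Y < n → ∑[ k < n ] 𝟙 ((X <ᵇ toℕ k) xor (Y <ᵇ toℕ k)) ≡ ∣ X - Y ∣
∑-xor-<ᵇ {suc n} {zero}  {zero}  _         _         = sum-replicate-zero n
∑-xor-<ᵇ {suc n} {zero}  {suc Y} _         (s≤s Y<n) = ∑-≮ᵇ Y<n
∑-xor-<ᵇ {suc n} {suc X} {zero}  (s≤s X<n) _         =
  trans (sum-cong-≗ {n} (λ k → cong 𝟙 (xor-comm (X <ᵇ toℕ k) true))) (∑-≮ᵇ X<n)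
∑-xor-<ᵇ {suc n} {suc X} {suc Y} (s≤s X<n) (s≤s Y<n) = ∑-xor-<ᵇ X<n Y<n

sum-tabulate : ∀ {n} (f : Fin n → ℕ) → sumᴸ (tabulate f) ≡ sum f
sum-tabulate {zero}  f = refl
sum-tabulate {suc n} f = cong (f fzero +_) (sum-tabulate (f ∘ fsuc))

-- Crossings of a cut

-- The cut k separates {1,…,k} from the larger positions and values; an entry i ↦ w(i) is
-- charged one for each of the points ±(k+½) strictly between i and w(i).  Here ℓ and σ say
-- whether i and |w(i)| are at most k, and ν whether w(i) < 0.
crossings : Bool → Bool → Bool → ℕ
crossings ℓ σ false = 𝟙 (ℓ xor σ)
crossings ℓ σ true  = 𝟙 (not ℓ) + 𝟙 (not σ)

low : ∀ {n} → ℕ → Fin n → Bool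
low k x = toℕ x <ᵇ k

cross : ∀ {n} → ℕ → SPerm n → Fin n → ℕ
cross k w x = crossings (low k x) (low k (perm w x)) (neg w x)

level : ∀ {n} → ℕ → SPerm n → ℕ
level {n} k w = ∑[ x < n ] cross k w x

∣⊖∣≡∣-∣ : ∀ a b → ℤ.∣ a ⊖ b ∣ ≡ ∣ a - b ∣
∣⊖∣≡∣-∣ a b with ≤-total a b
... | inj₁ a≤b = trans (ℤ.∣⊖∣-≤ a≤b) (sym (m≤n⇒∣m-n∣≡n∸m a≤b))
... | inj₂ b≤a = trans (ℤ.∣m⊖n∣≡∣n⊖m∣ a b)
                   (trans (ℤ.∣⊖∣-≤ b≤a) (trans (sym (m≤n⇒∣m-n∣≡n∸m b≤a)) (∣-∣-comm b a)))

displacement-cuts : ∀ {n} (w : SPerm n) x →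
                    ℤ.∣ val w x ℤ.- ℤ.+ suc (toℕ x) ∣ ≡ ∑[ k < n ] cross (toℕ k) w x
displacement-cuts {n} w x with neg w x
... | false = trans (∣⊖∣≡∣-∣ (suc (toℕ (perm w x))) (suc (toℕ x)))
                (trans (∣-∣-comm (toℕ (perm w x)) (toℕ x)) (sym (∑-xor-<ᵇ (toℕ<n x) (toℕ<n (perm w x)))))
... | true  = sym (trans (∑-distrib-+ {n} (λ k → 𝟙 (not (low (toℕ k) x))) (λ k → 𝟙 (not (low (toℕ k) (perm w x)))))
                (trans (cong₂ _+_ (∑-≮ᵇ (toℕ<n x)) (∑-≮ᵇ (toℕ<n (perm w x)))) (suc-+-suc (toℕ x) _)))
  where suc-+-suc : ∀ a b → suc a + suc b ≡ suc (suc (b + a))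
        suc-+-suc = solve-∀

tvd-cuts : ∀ {n} (w : SPerm n) → tvd w ≡ ∑[ k < n ] level (toℕ k) w
tvd-cuts {n} w = begin
  tvd w                                 ≡⟨ cong sumᴸ (map-tabulate id d) ⟩
  sumᴸ (tabulate d)                     ≡⟨ sum-tabulate d ⟩
  sum d                                 ≡⟨ sum-cong-≗ {n} (displacement-cuts w) ⟩
  ∑[ x < n ] ∑[ k < n ] cross (toℕ k) w x ≡⟨ ∑-comm {n} {n} (λ x k → cross (toℕ k) w x) ⟩
  ∑[ k < n ] level (toℕ k) w            ∎
  where
  open ≡-Reasoning
  d : Fin n → ℕ
  d x = ℤ.∣ val w x ℤ.- ℤ.+ suc (toℕ x) ∣

injective⇒surjective : ∀ {n} {π : Fin n → Fin n} → Injective _≡_ _≡_ π → ∀ y → ∃ λ x → π x ≡ y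
injective⇒surjective {suc n} {π} π-inj y with any? (λ x → π x Fin.≟ y)
... | yes hit = hit
... | no miss = ⊥-elim (collision (pigeonhole (n<1+n n) (λ x → punchOut (avoids x))))
  where
  avoids : ∀ x → y ≢ π x
  avoids x y≡πx = miss (x , sym y≡πx)
  collision : ¬ ∃₂ λ i j → i Fin.< j × punchOut (avoids i) ≡ punchOut (avoids j)
  collision (i , j , i<j , same) = <-irrefl (cong toℕ (π-inj (punchOut-injective (avoids i) (avoids j) same))) i<j

-- P and its preimage under π have the same size.
injective-reflects : ∀ {n} {π : Fin n → Fin n} → Injective _≡_ _≡_ π → (P : Fin n → Bool) →
                     (∀ x → P x ≡ true → P (π x) ≡ true) → ∀ x → P (π x) ≡ true → P x ≡ true
injective-reflects {n} {π} π-inj P P-invariant x Pπx =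
  𝟙-injective (trans (∑-mono-≤-≡ (λ x → 𝟙-mono (P-invariant x)) same-size x) (cong 𝟙 Pπx))
  where
  π⁻¹ : Fin n → Fin n
  π⁻¹ y = proj₁ (injective⇒surjective π-inj y)
  same-size : ∑[ x < n ] 𝟙 (P x) ≡ ∑[ x < n ] 𝟙 (P (π x))
  same-size = ∑-permute (𝟙 ∘ P) (permutation π π⁻¹ (λ y → proj₂ (injective⇒surjective π-inj y))
                                                  (λ x → π-inj (proj₂ (injective⇒surjective π-inj (π x)))))

all-tabulate⁻ : ∀ {A : Set} {n} (P : A → Bool) (f : Fin n → A) → all P (tabulate f) ≡ true → ∀ i → P (f i) ≡ true
all-tabulate⁻ P f all≡true fzero    with P (f fzero)
... | true = refl
all-tabulate⁻ P f all≡true (fsuc i) with P (f fzero)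
... | true = all-tabulate⁻ P (f ∘ fsuc) all≡true i

all-tabulate⁺ : ∀ {A : Set} {n} (P : A → Bool) (f : Fin n → A) → (∀ i → P (f i) ≡ true) → all P (tabulate f) ≡ true
all-tabulate⁺ {n = zero}  P f _   = refl
all-tabulate⁺ {n = suc n} P f all rewrite all fzero = all-tabulate⁺ P (f ∘ fsuc) (all ∘ fsuc)

any-tabulate⁻ : ∀ {A : Set} {n} (P : A → Bool) (f : Fin n → A) → any P (tabulate f) ≡ true → ∃ λ i → P (f i) ≡ true
any-tabulate⁻ {n = suc n} P f any≡true with P (f fzero) in hit
... | true  = fzero , hit
... | false with any-tabulate⁻ P (f ∘ fsuc) any≡true
...   | i , Pfi = fsuc i , Pfi

any-tabulate⁺ : ∀ {A : Set} {n} (P : A → Bool) (f : Fin n → A) i → P (f i) ≡ true → any P (tabulate f) ≡ true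
any-tabulate⁺ P f fzero    Pfi rewrite Pfi = refl
any-tabulate⁺ P f (fsuc i) Pfi with P (f fzero)
... | true  = refl
... | false = any-tabulate⁺ P (f ∘ fsuc) i Pfi

count-tabulate : ∀ {A : Set} {n} (P : A → Bool) (f : Fin n → A) →
                 length (filter (λ a → T? (P a)) (tabulate f)) ≡ ∑[ i < n ] 𝟙 (P (f i))
count-tabulate {n = zero}  P f = refl
count-tabulate {n = suc n} P f with P (f fzero)
... | true  = cong suc (count-tabulate P (f ∘ fsuc))
... | false = count-tabulate P (f ∘ fsuc)

count-applyUpTo : ∀ {A : Set} n (P : A → Bool) (f : ℕ → A) →
                  length (filter (λ a → T? (P a)) (applyUpTo f n)) ≡ ∑[ k < n ] 𝟙 (P (f (toℕ k)))
count-applyUpTo zero    P f = refl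
count-applyUpTo (suc n) P f with P (f 0)
... | true  = cong suc (count-applyUpTo n P (f ∘ suc))
... | false = count-applyUpTo n P (f ∘ suc)

-- Blocks and parity

Closed : ∀ {n} → SPerm n → ℕ → Set
Closed w k = ∀ x → low k x ≡ low k (perm w x)

module _ {n} (w : SPerm n) (w-inj : Injective _≡_ _≡_ (perm w)) (k : ℕ) where

  private
    maps-low : Fin n → Bool
    maps-low x = not (low k x) ∨ low k (perm w x)
    hits : Fin n → Fin n → Bool
    hits y x = low k x ∧ (toℕ (perm w x) ≡ᵇ toℕ y)
    covered : Fin n → Bool
    covered y = not (low k y) ∨ any (hits y) (tabulate id)

  closedB⇒Closed : closedB w k ≡ true → Closed w k
  closedB⇒Closed closed x = ≡-by-⇔ forth back
    where
    forth : low k x ≡ true → low k (perm w x) ≡ true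
    forth = ⇒ᵇ-elim (all-tabulate⁻ maps-low id (proj₁ (∧-true⁻ closed)) x)
    back : low k (perm w x) ≡ true → low k x ≡ true
    back wx-low with any-tabulate⁻ (hits (perm w x)) id
                       (⇒ᵇ-elim (all-tabulate⁻ covered id (proj₂ (∧-true⁻ closed)) (perm w x)) wx-low)
    ... | i , hit with ∧-true⁻ hit
    ...   | i-low , wi≡wx = subst (λ z → low k z ≡ true) (w-inj (toℕ-injective (≡ᵇ-true⁻¹ wi≡wx))) i-low

  Closed⇒closedB : Closed w k → closedB w k ≡ true
  Closed⇒closedB closed = cong₂ _∧_ (all-tabulate⁺ maps-low id into) (all-tabulate⁺ covered id onto)
    where
    into : ∀ x → maps-low x ≡ true
    into x = ⇒ᵇ-intro (λ x-low → trans (sym (closed x)) x-low)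
    onto : ∀ y → covered y ≡ true
    onto y = ⇒ᵇ-intro λ y-low → let (x , wx≡y) = injective⇒surjective w-inj y in
      any-tabulate⁺ (hits y) id x (cong₂ _∧_ (trans (closed x) (trans (cong (low k) wx≡y) y-low))
                                             (trans (cong (λ z → toℕ z ≡ᵇ toℕ y) wx≡y) (≡ᵇ-refl (toℕ y))))

closedB-cong : ∀ {n} {u v : SPerm n} → Injective _≡_ _≡_ (perm u) → Injective _≡_ _≡_ (perm v) → ∀ k →
               (∀ x → low k (perm u x) ≡ low k (perm v x)) → closedB u k ≡ closedB v k
closedB-cong {u = u} {v} u-inj v-inj k same = ≡-by-⇔
  (λ c → Closed⇒closedB v v-inj k (λ x → trans (closedB⇒Closed u u-inj k c x) (same x)))
  (λ c → Closed⇒closedB u u-inj k (λ x → trans (closedB⇒Closed v v-inj k c x) (sym (same x))))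

count-range1 : ∀ n (P : ℕ → Bool) → length (filter (λ j → T? (P j)) (range1 n)) ≡ ∑[ k < n ] 𝟙 (P (suc (toℕ k)))
count-range1 n P = trans (cong (λ js → length (filter (λ j → T? (P j)) js)) (map-applyUpTo id suc n))
                       (count-applyUpTo n P suc)

even-+ : ∀ a b → even (a + b) ≡ not (even a xor even b)
even-+ zero    b = sym (not-involutive (even b))
even-+ (suc a) b rewrite even-+ a b with even a
... | true  = not-involutive _
... | false = refl

xor-cancelʳ : ∀ x y z → x xor z ≡ y xor z → x ≡ y
xor-cancelʳ false false _     _  = refl
xor-cancelʳ true  true  _     _  = refl
xor-cancelʳ false true  false ()
xor-cancelʳ false true  true  ()
xor-cancelʳ true  false false ()
xor-cancelʳ true  false true  ()

even-+-cancelʳ : ∀ {a b c d} → a + c ≡ b + d → even c ≡ even d → even a ≡ even b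
even-+-cancelʳ {a} {b} {c} {d} a+c≡b+d c≈d = xor-cancelʳ (even a) (even b) (even c) (not-injective (begin
  not (even a xor even c) ≡⟨ sym (even-+ a c) ⟩
  even (a + c)            ≡⟨ cong even a+c≡b+d ⟩
  even (b + d)            ≡⟨ even-+ b d ⟩
  not (even b xor even d) ≡⟨ cong (λ e → not (even b xor e)) (sym c≈d) ⟩
  not (even b xor even c) ∎))
  where open ≡-Reasoning

negCount-sum : ∀ {n} (w : SPerm n) k → negCountUpTo w k ≡ ∑[ x < n ] 𝟙 (neg w x ∧ low k x)
negCount-sum w k = count-tabulate (λ x → neg w x ∧ low k x) id

negCount-split : ∀ {n} (w : SPerm n) k → negCountUpTo w n ≡ negCountUpTo w k + ∑[ x < n ] 𝟙 (neg w x ∧ not (low k x))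
negCount-split {n} w k = begin
  negCountUpTo w n                                  ≡⟨ negCount-sum w n ⟩
  ∑[ x < n ] 𝟙 (neg w x ∧ low n x)                  ≡⟨ sum-cong-≗ {n} everything-low ⟩
  ∑[ x < n ] (𝟙 (neg w x ∧ low k x) + 𝟙 (high x))  ≡⟨ ∑-distrib-+ {n} _ _ ⟩
  ∑[ x < n ] 𝟙 (neg w x ∧ low k x) + sum (𝟙 ∘ high) ≡⟨ cong (_+ sum (𝟙 ∘ high)) (sym (negCount-sum w k)) ⟩
  negCountUpTo w k + sum (𝟙 ∘ high)                 ∎
  where
  open ≡-Reasoning
  high : Fin n → Bool
  high x = neg w x ∧ not (low k x)
  everything-low : ∀ x → 𝟙 (neg w x ∧ low n x) ≡ 𝟙 (neg w x ∧ low k x) + 𝟙 (high x)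
  everything-low x = trans (cong (λ b → 𝟙 (neg w x ∧ b)) (<ᵇ-true (toℕ<n x)))
                           (trans (cong 𝟙 (∧-identityʳ (neg w x))) (𝟙-split (neg w x) (low k x)))

-- The potential

-- A cut of w ∈ S^D_n that closes a block with an odd number of negative entries is not a
-- block boundary in type D; each such cut is charged 2 on top of its crossings.
oddBlock : ∀ {n} → ℕ → SPerm n → ℕ
oddBlock k w = 𝟙 (closedB w k ∧ not (even (negCountUpTo w k)))

oddBlock≤1 : ∀ {n} k (w : SPerm n) → oddBlock k w ≤ 1
oddBlock≤1 k w = 𝟙≤1 _

oddBlock≡0 : ∀ {n} (w : SPerm n) k → (closedB w k ≡ true → even (negCountUpTo w k) ≡ false → ⊥) → oddBlock k w ≡ 0
oddBlock≡0 w k not-odd with closedB w k | even (negCountUpTo w k)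
... | false | _     = refl
... | true  | true  = refl
... | true  | false = ⊥-elim (not-odd refl refl)

weight : ∀ {n} → Kind → ℕ → SPerm n → ℕ
weight A k w = level k w
weight B k w = level k w
weight D k w = level k w + 2 * oddBlock k w

potential : ∀ {n} → Kind → SPerm n → ℕ
potential {n} X w = ∑[ k < n ] weight X (toℕ k) w

∑-shift : ∀ n (g : ℕ → ℕ) → g 0 ≡ 0 → g n ≡ 0 → ∑[ k < n ] g (toℕ k) ≡ ∑[ k < n ] g (suc (toℕ k))
∑-shift zero    g _  _  = refl
∑-shift (suc n) g g0 gn = begin
  g 0 + ∑[ k < n ] g (suc (toℕ k))                ≡⟨ cong (_+ ∑[ k < n ] g (suc (toℕ k))) g0 ⟩
  ∑[ k < n ] g (suc (toℕ k))                      ≡⟨ sym (+-identityʳ _) ⟩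
  ∑[ k < n ] g (suc (toℕ k)) + 0                  ≡⟨ cong₂ _+_ (sum-cong-≗ {n} (λ k → cong (g ∘ suc) (sym (toℕ-inject₁ k))))
                                                              (sym (trans (cong (g ∘ suc) (toℕ-fromℕ n)) gn)) ⟩
  ∑[ k < n ] g (suc (toℕ (inject₁ k))) + g (suc (toℕ (Fin.fromℕ n))) ≡⟨ sym (sum-init-last (g ∘ suc ∘ toℕ)) ⟩
  ∑[ k < suc n ] g (suc (toℕ k))                  ∎
  where open ≡-Reasoning

negCount-0 : ∀ {n} (w : SPerm n) → negCountUpTo w 0 ≡ 0
negCount-0 {n} w = trans (negCount-sum w 0) (∑-zero {n} λ x →
  trans (cong (λ b → 𝟙 (neg w x ∧ b)) (<ᵇ-false {toℕ x} z≤n)) (cong 𝟙 (∧-zeroʳ (neg w x))))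

oddBlock-0 : ∀ {n} (w : SPerm n) → oddBlock 0 w ≡ 0
oddBlock-0 w = trans (cong (λ m → 𝟙 (closedB w 0 ∧ not (even m))) (negCount-0 w)) (cong 𝟙 (∧-zeroʳ _))

oddBlock-top : ∀ {n} (w : SPerm n) → InGroup D w → oddBlock n w ≡ 0
oddBlock-top {n} w even-total rewrite even-total = cong 𝟙 (∧-zeroʳ (closedB w n))

∑-oddBlock : ∀ {n} (w : SPerm n) → InGroup D w → blD w + ∑[ k < n ] oddBlock (toℕ k) w ≡ blB w
∑-oddBlock {n} w w∈D = begin
  blD w + ∑[ k < n ] oddBlock (toℕ k) w
    ≡⟨ cong₂ _+_ (count-range1 n (λ j → closedB w j ∧ even (negCountUpTo w j)))
                 (∑-shift n (λ k → oddBlock k w) (oddBlock-0 w) (oddBlock-top w w∈D)) ⟩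
  ∑[ k < n ] 𝟙 (closedB w (suc (toℕ k)) ∧ even (negCountUpTo w (suc (toℕ k)))) + ∑[ k < n ] oddBlock (suc (toℕ k)) w
    ≡⟨ sym (∑-distrib-+ {n} _ _) ⟩
  ∑[ k < n ] (𝟙 (closedB w (suc (toℕ k)) ∧ even (negCountUpTo w (suc (toℕ k)))) + oddBlock (suc (toℕ k)) w)
    ≡⟨ sum-cong-≗ {n} (λ k → sym (𝟙-split (closedB w (suc (toℕ k))) _)) ⟩
  ∑[ k < n ] 𝟙 (closedB w (suc (toℕ k)))
    ≡⟨ sym (count-range1 n (closedB w)) ⟩
  blB w ∎
  where open ≡-Reasoning

potential-blocks : ∀ {n} X (w : SPerm n) → InGroup X w → potential X w + 2 * bl X w ≡ tvd w + 2 * blB w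
potential-blocks A w _ = cong (_+ 2 * blB w) (sym (tvd-cuts w))
potential-blocks B w _ = cong (_+ 2 * blB w) (sym (tvd-cuts w))
potential-blocks {n} D w w∈D = begin
  ∑[ k < n ] (level (toℕ k) w + 2 * oddBlock (toℕ k) w) + 2 * blD w
    ≡⟨ cong (_+ 2 * blD w) (trans (∑-distrib-+ {n} _ _) (cong₂ _+_ (sym (tvd-cuts w)) (∑-double {n} (λ k → oddBlock (toℕ k) w)))) ⟩
  tvd w + 2 * odd + 2 * blD w          ≡⟨ regroup (tvd w) odd (blD w) ⟩
  tvd w + 2 * (blD w + odd)            ≡⟨ cong (λ b → tvd w + 2 * b) (∑-oddBlock w w∈D) ⟩
  tvd w + 2 * blB w                    ∎
  where
  open ≡-Reasoning
  odd = ∑[ k < n ] oddBlock (toℕ k) w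
  regroup : ∀ t o b → t + 2 * o + 2 * b ≡ t + 2 * (b + o)
  regroup = solve-∀

swapFin-matchˡ : ∀ {n} (i j : Fin n) → swapFin i j i ≡ j
swapFin-matchˡ i j rewrite ≡ᵇ-refl (toℕ i) = refl

swapFin-matchʳ : ∀ {n} (i j : Fin n) → swapFin i j j ≡ i
swapFin-matchʳ i j with toℕ j ≡ᵇ toℕ i in j≡i
... | true  = toℕ-injective (≡ᵇ-true⁻¹ j≡i)
... | false rewrite ≡ᵇ-refl (toℕ j) = refl

swapFin-mismatch : ∀ {n} (i j x : Fin n) → x ≢ i → x ≢ j → swapFin i j x ≡ x
swapFin-mismatch i j x x≢i x≢j
  rewrite ≡ᵇ-false (x≢i ∘ toℕ-injective) | ≡ᵇ-false (x≢j ∘ toℕ-injective) = refl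

swapFin-involutive : ∀ {n} (i j x : Fin n) → swapFin i j (swapFin i j x) ≡ x
swapFin-involutive i j x with x Fin.≟ i | x Fin.≟ j
... | yes refl | _        = trans (cong (swapFin i j) (swapFin-matchˡ i j)) (swapFin-matchʳ i j)
... | no _     | yes refl = trans (cong (swapFin i j) (swapFin-matchʳ i j)) (swapFin-matchˡ i j)
... | no x≢i   | no x≢j   = trans (cong (swapFin i j) (swapFin-mismatch i j x x≢i x≢j)) (swapFin-mismatch i j x x≢i x≢j)

swapFin-injective : ∀ {n} (i j : Fin n) → Injective _≡_ _≡_ (swapFin i j)
swapFin-injective i j {x} {y} eq = trans (sym (swapFin-involutive i j x)) (trans (cong (swapFin i j) eq) (swapFin-involutive i j y))

-- ⟦ pos i j _ ⟧ and ⟦ ngt _ i j _ ⟧ are definitionally exchangeSP false i j and exchangeSP true i j.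
exchangeSP : ∀ {n} → Bool → Fin n → Fin n → SPerm n
exchangeSP s a b = sp (swapFin a b) (λ x → s ∧ ((toℕ x ≡ᵇ toℕ a) ∨ (toℕ x ≡ᵇ toℕ b)))

⟦⟧-injective : ∀ {X n} (t : Trans X n) → Injective _≡_ _≡_ (perm ⟦ t ⟧)
⟦⟧-injective (pos i j _)   = swapFin-injective i j
⟦⟧-injective (ngt _ i j _) = swapFin-injective i j
⟦⟧-injective (flp i)       = id

prod-injective : ∀ {X n} (ts : List (Trans X n)) → Injective _≡_ _≡_ (perm (prod ts))
prod-injective []       = id
prod-injective (t ∷ ts) = prod-injective ts ∘ ⟦⟧-injective t

-- For pos and ngt this is the crossing number of the entry i ↦ ±j.
cutCost : ∀ {X n} → Trans X n → ℕ → ℕ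
cutCost (pos i j _)   k = crossings (low k i) (low k j) false
cutCost (ngt _ i j _) k = crossings (low k i) (low k j) true
cutCost (flp i)       k = 𝟙 (not (low k i))

tcost-cuts : ∀ {X n} (t : Trans X n) → tcost t ≡ ∑[ k < n ] cutCost t (toℕ k)
tcost-cuts (pos i j _)   = sym (∑-xor-<ᵇ (toℕ<n i) (toℕ<n j))
tcost-cuts {n = n} (ngt _ i j _) = sym (trans (∑-distrib-+ {n} (λ k → 𝟙 (not (low (toℕ k) i))) _)
                                             (cong₂ _+_ (∑-≮ᵇ (toℕ<n i)) (∑-≮ᵇ (toℕ<n j))))
tcost-cuts (flp i)       = sym (∑-≮ᵇ (toℕ<n i))

∑-cutCost : ∀ {X n} (t : Trans X n) → ∑[ k < n ] (2 * cutCost t (toℕ k)) ≡ 2 * tcost t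
∑-cutCost {n = n} t = trans (∑-double {n} (cutCost t ∘ toℕ)) (cong (2 *_) (sym (tcost-cuts t)))

+-exchange-≤ : ∀ {L′ L old new c} → L′ + old ≡ L + new → new ≤ old + c → L′ ≤ L + c
+-exchange-≤ {L′} {L} {old} {new} {c} eq new≤old+c = +-cancelʳ-≤ old L′ (L + c) (begin
  L′ + old      ≡⟨ eq ⟩
  L + new       ≤⟨ +-monoʳ-≤ L new≤old+c ⟩
  L + (old + c) ≡⟨ cong (L +_) (+-comm old c) ⟩
  L + (c + old) ≡⟨ sym (+-assoc L c old) ⟩
  L + c + old   ∎)
  where open ≤-Reasoning

+-exchange-≥ : ∀ {L′ L old new c} → L′ + old ≡ L + new → new + c ≤ old → L′ + c ≤ L
+-exchange-≥ {L′} {L} {old} {new} {c} eq new+c≤old = +-cancelʳ-≤ old (L′ + c) L (begin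
  L′ + c + old  ≡⟨ +-assoc L′ c old ⟩
  L′ + (c + old) ≡⟨ cong (L′ +_) (+-comm c old) ⟩
  L′ + (old + c) ≡⟨ sym (+-assoc L′ old c) ⟩
  L′ + old + c  ≡⟨ cong (_+ c) eq ⟩
  L + new + c   ≡⟨ +-assoc L new c ⟩
  L + (new + c) ≤⟨ +-monoʳ-≤ L new+c≤old ⟩
  L + old       ∎)
  where open ≤-Reasoning

weight-≤ : ∀ {L′ L o′ o c} → L′ ≤ L + 2 * c → o′ ≤ o → L′ + 2 * o′ ≤ L + 2 * o + 2 * c
weight-≤ {L′} {L} {o′} {o} {c} L′≤L+2c o′≤o = begin
  L′ + 2 * o′           ≤⟨ +-mono-≤ L′≤L+2c (*-monoʳ-≤ 2 o′≤o) ⟩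
  L + 2 * c + 2 * o     ≡⟨ +-swap-last L (2 * c) (2 * o) ⟩
  L + 2 * o + 2 * c     ∎
  where open ≤-Reasoning

weight-≤-closed : ∀ {L′ L o′ o c} → L′ ≤ L → o′ ≤ c → L′ + 2 * o′ ≤ L + 2 * o + 2 * c
weight-≤-closed {L′} {L} {o′} {o} {c} L′≤L o′≤c = begin
  L′ + 2 * o′           ≤⟨ +-mono-≤ L′≤L (*-monoʳ-≤ 2 o′≤c) ⟩
  L + 2 * c             ≤⟨ +-monoˡ-≤ (2 * c) (m≤m+n L (2 * o)) ⟩
  L + 2 * o + 2 * c     ∎
  where open ≤-Reasoning

xor-true : ∀ b → b xor true ≡ not b
xor-true b = xor-comm b true

-- Crossings of the entries p ↦ ±a and q ↦ ±b, before and after the values a and b are exchanged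
-- (and both negated when s holds).
unexchanged : (ℓp ℓq σa σb νp νq : Bool) → ℕ
unexchanged ℓp ℓq σa σb νp νq = crossings ℓp σa νp + crossings ℓq σb νq

exchanged : (s ℓp ℓq σa σb νp νq : Bool) → ℕ
exchanged s ℓp ℓq σa σb νp νq = crossings ℓp σb (νp xor s) + crossings ℓq σa (νq xor s)

exchange-bound : ∀ s ℓp ℓq σa σb νp νq →
  exchanged s ℓp ℓq σa σb νp νq ≤ unexchanged ℓp ℓq σa σb νp νq + 2 * crossings σa σb s
exchange-bound = truth-table 0 7 tt

exchange-separated : ∀ s ℓp ℓq σa σb νp νq →
  ℓp ⊑ σb → σb ⊑ ℓp → ℓq ⊑ σa → σa ⊑ ℓq → σa ⊑ not σb → not σb ⊑ σa →
  exchanged s ℓp ℓq σa σb νp νq ≤ unexchanged ℓp ℓq σa σb νp νq + 0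
exchange-separated = truth-table 6 7 tt

separated-cost : ∀ s σa σb → σa ⊑ not σb → not σb ⊑ σa → 1 ≤ crossings σa σb s
separated-cost = truth-table 2 3 tt

parity-flip : ∀ s νp νq ℓ → even (𝟙 ((νp xor s) ∧ ℓ) + 𝟙 ((νq xor s) ∧ ℓ)) ≡ even (𝟙 (νp ∧ ℓ) + 𝟙 (νq ∧ ℓ))
parity-flip false νp νq ℓ rewrite xor-identityʳ νp | xor-identityʳ νq = refl
parity-flip true  true  true  true  = refl
parity-flip true  true  true  false = refl
parity-flip true  true  false true  = refl
parity-flip true  true  false false = refl
parity-flip true  false true  true  = refl
parity-flip true  false true  false = refl
parity-flip true  false false true  = refl
parity-flip true  false false false = refl

⊑-separated : ∀ {a b} → b ⊑ a → a ≢ b → a ≡ true × b ≡ false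
⊑-separated {true}  {false} _ _ = refl , refl
⊑-separated {true}  {true}  _ a≢b = ⊥-elim (a≢b refl)
⊑-separated {false} {false} _ a≢b = ⊥-elim (a≢b refl)

⊑-both : ∀ {a b} → a ≡ b → a ⊑ b × b ⊑ a
⊑-both refl = ⊑-reflexive refl , ⊑-reflexive refl

module Exchange {n} (u : SPerm n) (u-inj : Injective _≡_ _≡_ (perm u)) (s : Bool) {p q : Fin n} (p≢q : p ≢ q) where

  a b : Fin n
  a = perm u p
  b = perm u q

  u′ : SPerm n
  u′ = exchangeSP s a b ∘SP u

  u′-injective : Injective _≡_ _≡_ (perm u′)
  u′-injective = u-inj ∘ swapFin-injective a b

  perm-p : perm u′ p ≡ b
  perm-p = swapFin-matchˡ a b

  perm-q : perm u′ q ≡ a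
  perm-q = swapFin-matchʳ a b

  neg-p : neg u′ p ≡ neg u p xor s
  neg-p rewrite ≡ᵇ-refl (toℕ a) = cong (neg u p xor_) (∧-identityʳ s)

  neg-q : neg u′ q ≡ neg u q xor s
  neg-q rewrite ≡ᵇ-refl (toℕ b) | ∨-zeroʳ (toℕ b ≡ᵇ toℕ a) = cong (neg u q xor_) (∧-identityʳ s)

  module _ {x : Fin n} (x≢p : x ≢ p) (x≢q : x ≢ q) where

    private
      wx≢a : perm u x ≢ a
      wx≢a = x≢p ∘ u-inj
      wx≢b : perm u x ≢ b
      wx≢b = x≢q ∘ u-inj

    perm-other : perm u′ x ≡ perm u x
    perm-other = swapFin-mismatch a b (perm u x) wx≢a wx≢b

    neg-other : neg u′ x ≡ neg u x
    neg-other rewrite ≡ᵇ-false (wx≢a ∘ toℕ-injective) | ≡ᵇ-false (wx≢b ∘ toℕ-injective) | ∧-zeroʳ s =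
      xor-identityʳ (neg u x)

  module _ (k : ℕ) where

    cross-p : cross k u′ p ≡ crossings (low k p) (low k b) (neg u p xor s)
    cross-p rewrite perm-p | neg-p = refl

    cross-q : cross k u′ q ≡ crossings (low k q) (low k a) (neg u q xor s)
    cross-q rewrite perm-q | neg-q = refl

    old new : ℕ
    old = unexchanged (low k p) (low k q) (low k a) (low k b) (neg u p) (neg u q)
    new = exchanged s (low k p) (low k q) (low k a) (low k b) (neg u p) (neg u q)

    level-exchange : level k u′ + old ≡ level k u + new
    level-exchange = begin
      level k u′ + old                              ≡⟨ sym (+-assoc (level k u′) _ _) ⟩
      level k u′ + cross k u p + cross k u q        ≡⟨ ∑-update₂ (cross k u′) (cross k u) p≢q unchanged ⟩
      level k u + cross k u′ p + cross k u′ q       ≡⟨ +-assoc (level k u) _ _ ⟩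
      level k u + (cross k u′ p + cross k u′ q)     ≡⟨ cong (level k u +_) (cong₂ _+_ cross-p cross-q) ⟩
      level k u + new                               ∎
      where
      open ≡-Reasoning
      unchanged : ∀ x → x ≢ p → x ≢ q → cross k u′ x ≡ cross k u x
      unchanged x x≢p x≢q = cong₂ (crossings (low k x)) (cong (low k) (perm-other x≢p x≢q)) (neg-other x≢p x≢q)

    level-≤ : ∀ {c} → new ≤ old + c → level k u′ ≤ level k u + c
    level-≤ = +-exchange-≤ level-exchange

    level-≥ : ∀ {c} → new + c ≤ old → level k u′ + c ≤ level k u
    level-≥ = +-exchange-≥ level-exchange

    cost : ℕ
    cost = crossings (low k a) (low k b) s

    level-bound : level k u′ ≤ level k u + 2 * cost
    level-bound = level-≤ (exchange-bound s (low k p) (low k q) (low k a) (low k b) (neg u p) (neg u q))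

    level-separated : closedB u′ k ≡ true → low k a ≢ low k b → level k u′ ≤ level k u
    level-separated closed a≁b = subst (level k u′ ≤_) (+-identityʳ _) (level-≤
      (exchange-separated s (low k p) (low k q) (low k a) (low k b) (neg u p) (neg u q)
        (proj₁ (⊑-both p-side)) (proj₂ (⊑-both p-side)) (proj₁ (⊑-both q-side)) (proj₂ (⊑-both q-side))
        (proj₁ (⊑-both (¬-not a≁b))) (proj₂ (⊑-both (¬-not a≁b)))))
      where
      p-side : low k p ≡ low k b
      p-side = trans (closedB⇒Closed u′ u′-injective k closed p) (cong (low k) perm-p)
      q-side : low k q ≡ low k a
      q-side = trans (closedB⇒Closed u′ u′-injective k closed q) (cong (low k) perm-q)

    closedB-kept : low k a ≡ low k b → closedB u′ k ≡ closedB u k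
    closedB-kept a∼b = closedB-cong {u = u′} {u} u′-injective u-inj k same-side
      where
      same-side : ∀ x → low k (perm u′ x) ≡ low k (perm u x)
      same-side x with x Fin.≟ p | x Fin.≟ q
      ... | yes refl | _        = trans (cong (low k) perm-p) (sym a∼b)
      ... | no _     | yes refl = trans (cong (low k) perm-q) a∼b
      ... | no x≢p   | no x≢q   = cong (low k) (perm-other x≢p x≢q)

    parity-kept : low k p ≡ low k q → even (negCountUpTo u′ k) ≡ even (negCountUpTo u k)
    parity-kept p∼q = even-+-cancelʳ {negCountUpTo u′ k} {negCountUpTo u k} {g p + g q} {f p + f q} (begin
      negCountUpTo u′ k + (g p + g q) ≡⟨ cong (_+ (g p + g q)) (negCount-sum u′ k) ⟩
      sum f + (g p + g q)             ≡⟨ sym (+-assoc (sum f) _ _) ⟩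
      sum f + g p + g q               ≡⟨ ∑-update₂ f g p≢q unchanged ⟩
      sum g + f p + f q               ≡⟨ +-assoc (sum g) _ _ ⟩
      sum g + (f p + f q)             ≡⟨ cong (_+ (f p + f q)) (sym (negCount-sum u k)) ⟩
      negCountUpTo u k + (f p + f q)  ∎) flips-cancel
      where
      open ≡-Reasoning
      f g : Fin n → ℕ
      f x = 𝟙 (neg u′ x ∧ low k x)
      g x = 𝟙 (neg u x ∧ low k x)
      unchanged : ∀ x → x ≢ p → x ≢ q → f x ≡ g x
      unchanged x x≢p x≢q = cong (λ ν → 𝟙 (ν ∧ low k x)) (neg-other x≢p x≢q)
      flips-cancel : even (g p + g q) ≡ even (f p + f q)
      flips-cancel rewrite neg-p | neg-q | p∼q = sym (parity-flip s (neg u p) (neg u q) (low k q))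

    same-side-if-closed : closedB u k ≡ true → low k a ≡ low k b → low k p ≡ low k q
    same-side-if-closed closed a∼b =
      trans (closedB⇒Closed u u-inj k closed p) (trans a∼b (sym (closedB⇒Closed u u-inj k closed q)))

    oddBlock-kept : low k a ≡ low k b → oddBlock k u′ ≡ oddBlock k u
    oddBlock-kept a∼b with closedB u k in closed
    ... | false rewrite closedB-kept a∼b | closed = refl
    ... | true  rewrite closedB-kept a∼b | closed | parity-kept (same-side-if-closed closed a∼b) = refl

    weight-D-bound : weight D k u′ ≤ weight D k u + 2 * cost
    weight-D-bound with low k a Bool.≟ low k b
    ... | yes a∼b = weight-≤ {L = level k u} {c = cost} level-bound (≤-reflexive (oddBlock-kept a∼b))
    ... | no  a≁b = separated (closedB u′ k) refl
      where
      a∼¬b = ⊑-both (¬-not a≁b)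
      separated : ∀ c → closedB u′ k ≡ c → weight D k u′ ≤ weight D k u + 2 * cost
      separated true  closed = weight-≤-closed {L = level k u} {o = oddBlock k u} (level-separated closed a≁b)
        (≤-trans (oddBlock≤1 k u′) (separated-cost s (low k a) (low k b) (proj₁ a∼¬b) (proj₂ a∼¬b)))
      separated false open′  = weight-≤ {L = level k u} {c = cost} level-bound
        (subst (_≤ oddBlock k u) (sym (oddBlock≡0 u′ k (λ closed _ → true≢false (trans (sym closed) open′)))) z≤n)

  signs-kept : s ≡ false → ∀ x → neg u′ x ≡ neg u x
  signs-kept refl x = xor-identityʳ (neg u x)

  group-kept : ∀ X → (X ≡ A → s ≡ false) → InGroup X u → InGroup X u′
  group-kept A s≡false u∈A x = trans (signs-kept (s≡false refl) x) (u∈A x)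
  group-kept B _       _     = tt
  group-kept D _       u∈D   = trans (parity-kept n (trans (<ᵇ-true (toℕ<n p)) (sym (<ᵇ-true (toℕ<n q))))) u∈D

flip-bound : ∀ ℓ σ ν → crossings ℓ σ (not ν) ≤ crossings ℓ σ ν + 2 * 𝟙 (not σ)
flip-bound = truth-table 0 3 tt

module Flip {n} (u : SPerm n) (u-inj : Injective _≡_ _≡_ (perm u)) (p : Fin n) where

  a : Fin n
  a = perm u p

  u′ : SPerm n
  u′ = ⟦ flp a ⟧ ∘SP u

  module _ (k : ℕ) where

    old new : ℕ
    old = cross k u p
    new = crossings (low k p) (low k a) (not (neg u p))

    level-flip : level k u′ + old ≡ level k u + new
    level-flip = trans (∑-update (cross k u′) (cross k u) p unchanged) (cong (level k u +_) cross-p)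
      where
      unchanged : ∀ x → x ≢ p → cross k u′ x ≡ cross k u x
      unchanged x x≢p rewrite ≡ᵇ-false (x≢p ∘ u-inj ∘ toℕ-injective) =
        cong (crossings (low k x) (low k (perm u x))) (xor-identityʳ (neg u x))
      cross-p : cross k u′ p ≡ new
      cross-p rewrite ≡ᵇ-refl (toℕ a) = cong (crossings (low k p) (low k a)) (xor-true (neg u p))

    level-bound : level k u′ ≤ level k u + 2 * 𝟙 (not (low k a))
    level-bound = +-exchange-≤ level-flip (flip-bound (low k p) (low k a) (neg u p))

    level-≥ : ∀ {c} → new + c ≤ old → level k u′ + c ≤ level k u
    level-≥ = +-exchange-≥ level-flip

-- Lower bound

weight-after : ∀ {X n} (t : Trans X n) (u : SPerm n) → Injective _≡_ _≡_ (perm u) →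
               ∀ k → weight X k (⟦ t ⟧ ∘SP u) ≤ weight X k u + 2 * cutCost t k
weight-after {X} (pos i j i≢j) u u-inj k
  with injective⇒surjective u-inj i | injective⇒surjective u-inj j
... | p , refl | q , refl = by-kind X
  where
  open Exchange u u-inj false {p} {q} (i≢j ∘ cong (perm u))
  by-kind : ∀ X → weight X k u′ ≤ weight X k u + 2 * cost k
  by-kind A = level-bound k
  by-kind B = level-bound k
  by-kind D = weight-D-bound k
weight-after {X} (ngt X≢A i j i≢j) u u-inj k
  with injective⇒surjective u-inj i | injective⇒surjective u-inj j
... | p , refl | q , refl = by-kind X X≢A
  where
  open Exchange u u-inj true {p} {q} (i≢j ∘ cong (perm u))
  by-kind : ∀ X → X ≢ A → weight X k u′ ≤ weight X k u + 2 * cost k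
  by-kind A A≢A = ⊥-elim (A≢A refl)
  by-kind B _   = level-bound k
  by-kind D _   = weight-D-bound k
weight-after (flp i) u u-inj k with injective⇒surjective u-inj i
... | p , refl = Flip.level-bound u u-inj p k

potential-after : ∀ {X n} (t : Trans X n) (u : SPerm n) → Injective _≡_ _≡_ (perm u) →
                  potential X (⟦ t ⟧ ∘SP u) ≤ potential X u + 2 * tcost t
potential-after {X} {n} t u u-inj = begin
  potential X (⟦ t ⟧ ∘SP u)                                     ≤⟨ ∑-mono-≤ {n} (λ k → weight-after t u u-inj (toℕ k)) ⟩
  ∑[ k < n ] (weight X (toℕ k) u + 2 * cutCost t (toℕ k))      ≡⟨ ∑-distrib-+ {n} _ _ ⟩
  potential X u + ∑[ k < n ] (2 * cutCost t (toℕ k))           ≡⟨ cong (potential X u +_) (∑-cutCost t) ⟩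
  potential X u + 2 * tcost t                                   ∎
  where open ≤-Reasoning

potential-id : ∀ {n} X → potential X (idSP {n}) ≡ 0
potential-id {n} X = ∑-zero {n} (λ k → by-kind X (toℕ k))
  where
  level-id : ∀ k → level k (idSP {n}) ≡ 0
  level-id k = ∑-zero {n} (λ x → cong 𝟙 (xor-same (low k x)))
  oddBlock-id : ∀ k → oddBlock k (idSP {n}) ≡ 0
  oddBlock-id k = trans (cong (λ m → 𝟙 (closedB (idSP {n}) k ∧ not (even m))) (trans (negCount-sum (idSP {n}) k) (sum-replicate-zero n)))
                        (cong 𝟙 (∧-zeroʳ (closedB (idSP {n}) k)))
  by-kind : ∀ X k → weight X k (idSP {n}) ≡ 0
  by-kind A k = level-id k
  by-kind B k = level-id k
  by-kind D k = cong₂ (λ l o → l + 2 * o) (level-id k) (oddBlock-id k)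

val-injective : ∀ {n} (u v : SPerm n) x → val u x ≡ val v x → perm u x ≡ perm v x × neg u x ≡ neg v x
val-injective u v x eq with neg u x | neg v x
... | false | false = toℕ-injective (suc-injective (ℤ.+-injective eq)) , refl
... | true  | true  = toℕ-injective (suc-injective (ℤ.+-injective (ℤ.neg-injective eq))) , refl
... | false | true  with eq
...   | ()
val-injective u v x eq | true | false with eq
...   | ()

potential-cong : ∀ {n} X {u v : SPerm n} → Injective _≡_ _≡_ (perm u) → Injective _≡_ _≡_ (perm v) → u ≈ v →
                 potential X u ≡ potential X v
potential-cong {n} X {u} {v} u-inj v-inj u≈v = sum-cong-≗ {n} (λ k → by-kind X (toℕ k))
  where
  same-perm : ∀ x → perm u x ≡ perm v x
  same-perm x = proj₁ (val-injective u v x (u≈v x))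
  same-neg : ∀ x → neg u x ≡ neg v x
  same-neg x = proj₂ (val-injective u v x (u≈v x))
  level-cong : ∀ k → level k u ≡ level k v
  level-cong k = sum-cong-≗ {n} (λ x → cong₂ (crossings (low k x)) (cong (low k) (same-perm x)) (same-neg x))
  negCount-cong : ∀ k → negCountUpTo u k ≡ negCountUpTo v k
  negCount-cong k = trans (negCount-sum u k) (trans (sum-cong-≗ {n} (λ x → cong (λ ν → 𝟙 (ν ∧ low k x)) (same-neg x)))
                                                    (sym (negCount-sum v k)))
  oddBlock-cong : ∀ k → oddBlock k u ≡ oddBlock k v
  oddBlock-cong k = cong₂ (λ c m → 𝟙 (c ∧ not (even m)))
                          (closedB-cong {u = u} {v} u-inj v-inj k (λ x → cong (low k) (same-perm x))) (negCount-cong k)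
  by-kind : ∀ X k → weight X k u ≡ weight X k v
  by-kind A k = level-cong k
  by-kind B k = level-cong k
  by-kind D k = cong₂ (λ l o → l + 2 * o) (level-cong k) (oddBlock-cong k)

potential≤cost : ∀ {X n} (ts : List (Trans X n)) → potential X (prod ts) ≤ 2 * totalCost ts
potential≤cost {X} {n} []       = ≤-reflexive (potential-id {n} X)
potential≤cost {X} (t ∷ ts) = begin
  potential X (⟦ t ⟧ ∘SP prod ts)       ≤⟨ potential-after t (prod ts) (prod-injective ts) ⟩
  potential X (prod ts) + 2 * tcost t   ≤⟨ +-monoˡ-≤ (2 * tcost t) (potential≤cost ts) ⟩
  2 * totalCost ts + 2 * tcost t        ≡⟨ trans (+-comm (2 * totalCost ts) _) (sym (*-distribˡ-+ 2 (tcost t) (totalCost ts))) ⟩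
  2 * totalCost (t ∷ ts)                ∎
  where open ≤-Reasoning

lower-bound : ∀ {X n} (w : SPerm n) → Injective _≡_ _≡_ (perm w) →
              (ts : List (Trans X n)) → prod ts ≈ w → potential X w ≤ 2 * totalCost ts
lower-bound {X} w w-inj ts ts≈w =
  subst (_≤ 2 * totalCost ts) (potential-cong X (prod-injective ts) w-inj ts≈w) (potential≤cost ts)

Improvement : ∀ {n} → Kind → SPerm n → Set
Improvement {n} X w = Σ (Trans X n) λ t → (potential X (⟦ t ⟧ ∘SP w) + 2 * tcost t ≤ potential X w) × InGroup X (⟦ t ⟧ ∘SP w)

potential-tight : ∀ {X n} (t : Trans X n) (u : SPerm n) → (∀ k → weight X k (⟦ t ⟧ ∘SP u) + 2 * cutCost t k ≤ weight X k u) →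
                  potential X (⟦ t ⟧ ∘SP u) + 2 * tcost t ≤ potential X u
potential-tight {X} {n} t u tight = begin
  potential X (⟦ t ⟧ ∘SP u) + 2 * tcost t                 ≡⟨ cong (potential X (⟦ t ⟧ ∘SP u) +_) (sym (∑-cutCost t)) ⟩
  potential X (⟦ t ⟧ ∘SP u) + ∑[ k < n ] (2 * cutCost t (toℕ k)) ≡⟨ sym (∑-distrib-+ {n} _ _) ⟩
  ∑[ k < n ] (weight X (toℕ k) (⟦ t ⟧ ∘SP u) + 2 * cutCost t (toℕ k)) ≤⟨ ∑-mono-≤ {n} (tight ∘ toℕ) ⟩
  potential X u                                            ∎
  where open ≤-Reasoning

weight-D-tight : ∀ {L′ L o′ o c} → L′ + c ≤ L → o′ ≤ o → L′ + 2 * o′ + c ≤ L + 2 * o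
weight-D-tight {L′} {L} {o′} {o} {c} L′+c≤L o′≤o = begin
  L′ + 2 * o′ + c   ≡⟨ +-swap-last L′ (2 * o′) c ⟩
  L′ + c + 2 * o′   ≤⟨ +-mono-≤ L′+c≤L (*-monoʳ-≤ 2 o′≤o) ⟩
  L + 2 * o         ∎
  where open ≤-Reasoning

max-search : ∀ {n} {P : Fin n → Set} → Decidable P → (∀ x → ¬ P x) ⊎ ∃ λ x → P x × (∀ y → toℕ x < toℕ y → ¬ P y)
max-search {zero}  P? = inj₁ λ ()
max-search {suc n} P? with max-search (P? ∘ fsuc)
... | inj₂ (x , Px , above) = inj₂ (fsuc x , Px , λ { fzero () ; (fsuc y) (s≤s x<y) → above y x<y })
... | inj₁ none with P? fzero
...   | yes P0 = inj₂ (fzero , P0 , λ { fzero () ; (fsuc y) _ → none y })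
...   | no ¬P0 = inj₁ λ { fzero → ¬P0 ; (fsuc y) → none y }

Fixed : ∀ {n} → SPerm n → Fin n → Set
Fixed w x = perm w x ≡ x × neg w x ≡ false

fixed? : ∀ {n} (w : SPerm n) → Decidable (Fixed w)
fixed? w x = (perm w x Fin.≟ x) ×-dec (neg w x Bool.≟ false)

all-fixed⇒id : ∀ {n} (w : SPerm n) → (∀ x → Fixed w x) → w ≈ idSP
all-fixed⇒id w fixed x rewrite proj₁ (fixed x) | proj₂ (fixed x) = refl

-- Positions and values are 0-based: in the paper's notation w(I+1) = ±(M+1).
module LastMoved {n} (w : SPerm n) (w-inj : Injective _≡_ _≡_ (perm w)) (i : Fin n)
              (i-moved : ¬ Fixed w i) (fixed-above : ∀ y → toℕ i < toℕ y → Fixed w y) where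

  I M : ℕ
  I = toℕ i
  M = toℕ (perm w i)

  image-bound : ∀ x → toℕ x ≤ I → toℕ (perm w x) ≤ I
  image-bound x x≤I with ≤-<-connex (toℕ (perm w x)) I
  ... | inj₁ wx≤I = wx≤I
  ... | inj₂ I<wx = ⊥-elim (<⇒≱ (subst (λ z → I < toℕ z) (sym x≡wx) I<wx) x≤I)
    where x≡wx : x ≡ perm w x
          x≡wx = w-inj (sym (proj₁ (fixed-above (perm w x) I<wx)))

  negative-bound : ∀ x → neg w x ≡ true → toℕ x ≤ I
  negative-bound x negative with ≤-<-connex (toℕ x) I
  ... | inj₁ x≤I = x≤I
  ... | inj₂ I<x with trans (sym (proj₂ (fixed-above x I<x))) negative
  ...   | ()

  M≤I : M ≤ I
  M≤I = image-bound i ≤-refl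

negative-beyond : ∀ {n} (w : SPerm n) k → InGroup D w → even (negCountUpTo w k) ≡ false →
                  ∃ λ r → k ≤ toℕ r × neg w r ≡ true
negative-beyond {n} w k w∈D odd with any? (λ x → (k ≤? toℕ x) ×-dec (neg w x Bool.≟ true))
... | yes (r , k≤r , negative) = r , k≤r , negative
... | no none with trans (sym odd) (trans (cong even (sym prefix≡total)) w∈D)
  where
  nothing-beyond : ∀ x → 𝟙 (neg w x ∧ not (low k x)) ≡ 0
  nothing-beyond x with neg w x in negative | low k x in x-low
  ... | false | _     = refl
  ... | true  | true  = refl
  ... | true  | false = ⊥-elim (none (x , <ᵇ-false⁻¹ x-low , negative))
  prefix≡total : negCountUpTo w n ≡ negCountUpTo w k
  prefix≡total = trans (negCount-split w k) (trans (cong (negCountUpTo w k +_) (∑-zero {n} nothing-beyond)) (+-identityʳ _))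
...   | ()

exchange-tight₁ : ∀ ℓp ℓq σa σb νp νq → νp ⊑ false → ℓp ⊑ σb → σb ⊑ σa → σa ⊑ ℓq →
  exchanged false ℓp ℓq σa σb νp νq + 2 * crossings σa σb false ≤ unexchanged ℓp ℓq σa σb νp νq
exchange-tight₁ = truth-table 4 6 tt

exchange-tight₂ : ∀ ℓp ℓq σa σb νp νq → νp ⊑ false → ℓp ⊑ σb → σb ⊑ σa → true ⊑ νq →
  exchanged false ℓp ℓq σa σb νp νq + 2 * crossings σa σb false ≤ unexchanged ℓp ℓq σa σb νp νq
exchange-tight₂ = truth-table 4 6 tt

module ImprovePositive {X n} (w : SPerm n) (w∈X : InGroup X w) (w-inj : Injective _≡_ _≡_ (perm w)) (i : Fin n)
             (i-moved : ¬ Fixed w i) (fixed-above : ∀ y → toℕ i < toℕ y → Fixed w y) (i-positive : neg w i ≡ false) where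
  open LastMoved w w-inj i i-moved fixed-above

  M<I : M < I
  M<I = ≤∧≢⇒< M≤I (λ M≡I → i-moved (toℕ-injective M≡I , i-positive))

  Candidate : Fin n → Set
  Candidate q = (toℕ q ≤ M ⊎ neg w q ≡ true) × M < toℕ (perm w q) × toℕ (perm w q) ≤ I

  candidate? : Decidable Candidate
  candidate? q = ((toℕ q ≤? M) ⊎-dec (neg w q Bool.≟ true)) ×-dec (M <? toℕ (perm w q)) ×-dec (toℕ (perm w q) ≤? I)

  -- Otherwise w would map {1,…,M+1} into itself although w(I+1) = M+1 with I > M.
  some-candidate : ∃ Candidate
  some-candidate with any? (λ x → (toℕ x ≤? M) ×-dec (M <? toℕ (perm w x)))
  ... | yes (x , x≤M , M<wx) = x , inj₁ x≤M , M<wx , image-bound x (≤-trans x≤M M≤I)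
  ... | no none = ⊥-elim (<⇒≱ M<I (s≤s⁻¹ (<ᵇ-true⁻¹ i-low)))
    where
    stays-low : ∀ x → (toℕ x <ᵇ suc M) ≡ true → (toℕ (perm w x) <ᵇ suc M) ≡ true
    stays-low x x≤M = <ᵇ-true (s≤s (≮⇒≥ (λ M<wx → none (x , s≤s⁻¹ (<ᵇ-true⁻¹ x≤M) , M<wx))))
    i-low : (I <ᵇ suc M) ≡ true
    i-low = injective-reflects w-inj (λ x → toℕ x <ᵇ suc M) stays-low i (<ᵇ-true {M} ≤-refl)

  improvement : Improvement X w
  improvement with max-search candidate?
  ... | inj₁ none = ⊥-elim (none _ (proj₂ some-candidate))
  ... | inj₂ (q , (q-low⊎negative , M<B , B≤I) , last) = t , potential-tight t w tight , group-kept X (λ _ → refl) w∈X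
    where
    a≢b : perm w i ≢ perm w q
    a≢b wi≡wq = <-irrefl (cong toℕ wi≡wq) M<B
    t : Trans X n
    t = pos (perm w i) (perm w q) a≢b
    open Exchange w w-inj false {i} {q} (a≢b ∘ cong (perm w))

    level-tight : ∀ k → level k u′ + 2 * cost k ≤ level k w
    level-tight k = level-≥ k (by-sign q-low⊎negative)
      where
      I⊑B = <ᵇ-antitone k B≤I
      B⊑M = <ᵇ-antitone k (<⇒≤ M<B)
      by-sign : toℕ q ≤ M ⊎ neg w q ≡ true → new k + 2 * cost k ≤ old k
      by-sign (inj₁ q≤M)      = exchange-tight₁ (low k i) (low k q) (low k a) (low k b) (neg w i) (neg w q)
                                  (⊑-reflexive i-positive) I⊑B B⊑M (<ᵇ-antitone k q≤M)
      by-sign (inj₂ negative) = exchange-tight₂ (low k i) (low k q) (low k a) (low k b) (neg w i) (neg w q)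
                                  (⊑-reflexive i-positive) I⊑B B⊑M (⊑-reflexive (sym negative))

    oddBlock-mono : InGroup D u′ → ∀ k → oddBlock k u′ ≤ oddBlock k w
    oddBlock-mono u′∈D k with low k a Bool.≟ low k b
    ... | yes a∼b = ≤-reflexive (oddBlock-kept k a∼b)
    ... | no  a≁b = subst (_≤ oddBlock k w) (sym (oddBlock≡0 u′ k impossible)) z≤n
      where
      impossible : closedB u′ k ≡ true → even (negCountUpTo u′ k) ≡ false → ⊥
      impossible closed odd with negative-beyond u′ k u′∈D odd
      ... | r , k≤r , r-negative = last r (<-≤-trans q<k k≤r) (inj₂ r-negative-before , <-≤-trans M<k k≤wr , wr≤I)
        where
        M-low = ⊑-separated (<ᵇ-antitone k (<⇒≤ M<B)) a≁b
        M<k : M < k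
        M<k = <ᵇ-true⁻¹ (proj₁ M-low)
        q<k : toℕ q < k
        q<k = <ᵇ-true⁻¹ (trans (closedB⇒Closed u′ u′-injective k closed q) (trans (cong (low k) perm-q) (proj₁ M-low)))
        r≢i : r ≢ i
        r≢i refl with trans (sym r-negative) (trans neg-p (trans (xor-identityʳ _) i-positive))
        ... | ()
        r≢q : r ≢ q
        r≢q refl = <-irrefl refl (<-≤-trans q<k k≤r)
        r-negative-before : neg w r ≡ true
        r-negative-before = trans (sym (neg-other r≢i r≢q)) r-negative
        k≤wr : k ≤ toℕ (perm w r)
        k≤wr = <ᵇ-false⁻¹ (trans (sym (cong (low k) (perm-other r≢i r≢q)))
                                 (trans (sym (closedB⇒Closed u′ u′-injective k closed r)) (<ᵇ-false k≤r)))
        wr≤I : toℕ (perm w r) ≤ I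
        wr≤I = image-bound r (negative-bound r r-negative-before)

    tight : ∀ k → weight X k u′ + 2 * cost k ≤ weight X k w
    tight k = by-kind X w∈X
      where
      by-kind : ∀ X → InGroup X w → weight X k u′ + 2 * cost k ≤ weight X k w
      by-kind A _   = level-tight k
      by-kind B _   = level-tight k
      by-kind D w∈D = weight-D-tight {level k u′} {level k w} {oddBlock k u′} {oddBlock k w}
                        (level-tight k) (oddBlock-mono (group-kept D (λ ()) w∈D) k)

flip-tight : ∀ ℓ σ ν → true ⊑ ν → ℓ ⊑ σ → crossings ℓ σ (not ν) + 2 * 𝟙 (not σ) ≤ crossings ℓ σ ν
flip-tight = truth-table 2 3 tt

module ImproveNegativeB {n} (w : SPerm n) (w-inj : Injective _≡_ _≡_ (perm w)) (i : Fin n)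
             (i-moved : ¬ Fixed w i) (fixed-above : ∀ y → toℕ i < toℕ y → Fixed w y) (i-negative : neg w i ≡ true) where
  open LastMoved w w-inj i i-moved fixed-above

  improvement : Improvement B w
  improvement = flp (perm w i) , potential-tight (flp (perm w i)) w tight , tt
    where
    tight : ∀ k → weight B k (⟦ flp (perm w i) ⟧ ∘SP w) + 2 * cutCost (flp (perm w i)) k ≤ weight B k w
    tight k = Flip.level-≥ w w-inj i k
      (flip-tight (low k i) (low k (perm w i)) (neg w i) (⊑-reflexive (sym i-negative)) (<ᵇ-antitone k M≤I))

exchange-tight₃ : ∀ ℓp ℓq σa σb νp νq → νp ⊑ false → true ⊑ νq → σb ⊑ σa → ℓp ⊑ σb → ℓq ⊑ ℓp →
  exchanged false ℓp ℓq σa σb νp νq + 2 * crossings σa σb false ≤ unexchanged ℓp ℓq σa σb νp νq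
exchange-tight₃ = truth-table 5 6 tt

exchange-tight₄ : ∀ ℓp ℓq σa σb νp νq → true ⊑ νp → true ⊑ νq → ℓq ⊑ ℓp → ℓp ⊑ σb → ℓq ⊑ σa →
  exchanged true ℓp ℓq σa σb νp νq + 2 * crossings σa σb true ≤ unexchanged ℓp ℓq σa σb νp νq
exchange-tight₄ = truth-table 5 6 tt

exchange-at-block-end : ∀ ℓp ℓq σa σb νp νq → true ⊑ ℓp → true ⊑ σa → σb ⊑ false → ℓq ⊑ false → true ⊑ νq →
  exchanged false ℓp ℓq σa σb νp νq ≤ unexchanged ℓp ℓq σa σb νp νq + 0
exchange-at-block-end = truth-table 5 6 tt

module ImproveNegativeD {n} (w : SPerm n) (w∈D : InGroup D w) (w-inj : Injective _≡_ _≡_ (perm w)) (i : Fin n)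
             (i-moved : ¬ Fixed w i) (fixed-above : ∀ y → toℕ i < toℕ y → Fixed w y) (i-negative : neg w i ≡ true) where
  open LastMoved w w-inj i i-moved fixed-above

  Candidate : Fin n → Set
  Candidate q = M ≤ toℕ q × toℕ q < I × (neg w q ≡ true ⊎ toℕ (perm w q) < M)

  candidate? : Decidable Candidate
  candidate? q = (M ≤? toℕ q) ×-dec (toℕ q <? I) ×-dec ((neg w q Bool.≟ true) ⊎-dec (toℕ (perm w q) <? M))

  module _ {q : Fin n} (M≤q : M ≤ toℕ q) (q<I : toℕ q < I) where

    q≢i : q ≢ i
    q≢i refl = <-irrefl refl q<I

    exchange-below : neg w q ≡ false → toℕ (perm w q) < M → Improvement D w
    exchange-below q-positive A<M = t , potential-tight t w tight , group-kept D (λ ()) w∈D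
      where
      open Exchange w w-inj false {q} {i} q≢i
      t : Trans D n
      t = pos a b (q≢i ∘ w-inj)
      tight : ∀ k → weight D k u′ + 2 * cost k ≤ weight D k w
      tight k = weight-D-tight {level k u′} {level k w} {oddBlock k u′} {oddBlock k w} level-tight oddBlock-mono
        where
        level-tight : level k u′ + 2 * cost k ≤ level k w
        level-tight = level-≥ k (exchange-tight₃ (low k q) (low k i) (low k a) (low k b) (neg w q) (neg w i)
          (⊑-reflexive q-positive) (⊑-reflexive (sym i-negative)) (<ᵇ-antitone k (<⇒≤ A<M))
          (<ᵇ-antitone k M≤q) (<ᵇ-antitone k (<⇒≤ q<I)))
        oddBlock-mono : oddBlock k u′ ≤ oddBlock k w
        oddBlock-mono with low k a Bool.≟ low k b
        ... | yes a∼b = ≤-reflexive (oddBlock-kept k a∼b)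
        ... | no  a≁b = subst (_≤ oddBlock k w) (sym (oddBlock≡0 u′ k (λ closed _ → impossible closed))) z≤n
          where
          impossible : closedB u′ k ≡ true → ⊥
          impossible closed with ⊑-separated (<ᵇ-antitone k (<⇒≤ A<M)) a≁b
          ... | A-low , M-high = <⇒≱ (<-trans q<I I<k) (<ᵇ-false⁻¹ q-high)
            where
            I<k : I < k
            I<k = <ᵇ-true⁻¹ (trans (closedB⇒Closed u′ u′-injective k closed i) (trans (cong (low k) perm-q) A-low))
            q-high : low k q ≡ false
            q-high = trans (closedB⇒Closed u′ u′-injective k closed q) (trans (cong (low k) perm-p) M-high)

    exchange-negative : neg w q ≡ true → (∀ y → toℕ q < toℕ y → ¬ Candidate y) → Improvement D w
    exchange-negative q-negative last = t , potential-tight t w tight , group-kept D (λ ()) w∈D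
      where
      open Exchange w w-inj true {q} {i} q≢i
      t : Trans D n
      t = ngt (λ ()) a b (q≢i ∘ w-inj)
      tight : ∀ k → weight D k u′ + 2 * cost k ≤ weight D k w
      tight k = weight-D-tight {level k u′} {level k w} {oddBlock k u′} {oddBlock k w} level-tight oddBlock-mono
        where
        level-tight : level k u′ + 2 * cost k ≤ level k w
        level-tight = level-≥ k (exchange-tight₄ (low k q) (low k i) (low k a) (low k b) (neg w q) (neg w i)
          (⊑-reflexive (sym q-negative)) (⊑-reflexive (sym i-negative)) (<ᵇ-antitone k (<⇒≤ q<I))
          (<ᵇ-antitone k M≤q) (<ᵇ-antitone k (image-bound q (<⇒≤ q<I))))
        oddBlock-mono : oddBlock k u′ ≤ oddBlock k w
        oddBlock-mono with low k a Bool.≟ low k b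
        ... | yes a∼b = ≤-reflexive (oddBlock-kept k a∼b)
        ... | no  a≁b = subst (_≤ oddBlock k w) (sym (oddBlock≡0 u′ k impossible)) z≤n
          where
          impossible : closedB u′ k ≡ true → even (negCountUpTo u′ k) ≡ false → ⊥
          impossible closed odd = by-side (low k a) refl
            where
            q∼M : low k q ≡ low k b
            q∼M = trans (closedB⇒Closed u′ u′-injective k closed q) (cong (low k) perm-p)
            i∼A : low k i ≡ low k a
            i∼A = trans (closedB⇒Closed u′ u′-injective k closed i) (cong (low k) perm-q)
            by-side : ∀ β → low k a ≡ β → ⊥
            by-side true  A-low = a≁b (trans A-low (sym (trans (sym q∼M) (<ᵇ-true {n = k} (<-trans q<I (<ᵇ-true⁻¹ (trans i∼A A-low)))))))
            by-side false A-high with negative-beyond u′ k (group-kept D (λ ()) w∈D) odd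
            ... | r , k≤r , r-negative = last r q<r (≤-trans M≤q (<⇒≤ q<r) , r<I , inj₁ r-negative-before)
              where
              q<k : toℕ q < k
              q<k = <ᵇ-true⁻¹ (trans q∼M (trans (¬-not (a≁b ∘ sym)) (cong not A-high)))
              r≢i : r ≢ i
              r≢i refl with trans (sym r-negative) (trans neg-q (cong (_xor true) i-negative))
              ... | ()
              q<r : toℕ q < toℕ r
              q<r = <-≤-trans q<k k≤r
              r≢q : r ≢ q
              r≢q refl = <-irrefl refl q<r
              r-negative-before : neg w r ≡ true
              r-negative-before = trans (sym (neg-other r≢q r≢i)) r-negative
              r<I : toℕ r < I
              r<I = ≤∧≢⇒< (negative-bound r r-negative-before) (r≢i ∘ toℕ-injective)

  -- Without a candidate, {1,…,M} is a block containing an odd number of negative entries, and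
  -- exchanging the values M and M+1 opens it.
  module NoCandidate (none : ∀ x → ¬ Candidate x) where

    settled-above : ∀ x → M ≤ toℕ x → x ≢ i → neg w x ≡ false × M ≤ toℕ (perm w x)
    settled-above x M≤x x≢i with ≤-<-connex (toℕ x) I
    ... | inj₂ I<x = proj₂ (fixed-above x I<x) , subst (λ z → M ≤ toℕ z) (sym (proj₁ (fixed-above x I<x))) M≤x
    ... | inj₁ x≤I = ¬-not (λ negative → none x (M≤x , x<I , inj₁ negative)) , ≮⇒≥ (λ wx<M → none x (M≤x , x<I , inj₂ wx<M))
      where x<I = ≤∧≢⇒< x≤I (x≢i ∘ toℕ-injective)

    closed-at-M : Closed w M
    closed-at-M x = not-injective (≡-by-⇔ (high-invariant x) (injective-reflects w-inj high high-invariant x))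
      where
      high : Fin n → Bool
      high x = not (low M x)
      high-invariant : ∀ x → high x ≡ true → high (perm w x) ≡ true
      high-invariant x x-high with x Fin.≟ i
      ... | yes refl = cong not (<ᵇ-false {toℕ (perm w i)} ≤-refl)
      ... | no  x≢i  = cong not (<ᵇ-false (proj₂ (settled-above x (<ᵇ-false⁻¹ (not-injective x-high)) x≢i)))

    one-negative-above : ∑[ x < n ] 𝟙 (neg w x ∧ not (low M x)) ≡ 1
    one-negative-above = trans (∑-single i only-i) at-i
      where
      only-i : ∀ x → x ≢ i → 𝟙 (neg w x ∧ not (low M x)) ≡ 0
      only-i x x≢i with low M x in x-low
      ... | true  = cong 𝟙 (∧-zeroʳ (neg w x))
      ... | false rewrite proj₁ (settled-above x (<ᵇ-false⁻¹ x-low) x≢i) = refl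
      at-i : 𝟙 (neg w i ∧ not (low M i)) ≡ 1
      at-i rewrite i-negative | <ᵇ-false {I} M≤I = refl

    odd-below-M : even (negCountUpTo w M) ≡ false
    odd-below-M = not-injective (begin
      not (even (negCountUpTo w M))              ≡⟨ sym (cong not (xor-identityʳ _)) ⟩
      not (even (negCountUpTo w M) xor even 1)   ≡⟨ sym (even-+ (negCountUpTo w M) 1) ⟩
      even (negCountUpTo w M + 1)                ≡⟨ cong (λ m → even (negCountUpTo w M + m)) (sym one-negative-above) ⟩
      even (negCountUpTo w M + ∑[ x < n ] 𝟙 (neg w x ∧ not (low M x))) ≡⟨ cong even (sym (negCount-split w M)) ⟩
      even (negCountUpTo w n)                    ≡⟨ w∈D ⟩
      true                                       ∎)
      where open ≡-Reasoning

    M≢0 : M ≢ 0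
    M≢0 M≡0 with trans (sym odd-below-M) (cong even (trans (cong (negCountUpTo w) M≡0) (negCount-0 w)))
    ... | ()

    M′ : ℕ
    M′ = pred M

    suc-M′ : suc M′ ≡ M
    suc-M′ = suc-pred M {{≢-nonZero M≢0}}

    M′<M : M′ < M
    M′<M = ≤-reflexive suc-M′

    q₀ : Fin n
    q₀ = proj₁ (injective⇒surjective w-inj (fromℕ< (<-≤-trans M′<M (≤-trans M≤I (<⇒≤ (toℕ<n i))))))

    value-q₀ : toℕ (perm w q₀) ≡ M′
    value-q₀ = trans (cong toℕ (proj₂ (injective⇒surjective w-inj _))) (toℕ-fromℕ< _)

    q₀≢i : q₀ ≢ i
    q₀≢i q₀≡i = <-irrefl (trans (sym value-q₀) (cong (toℕ ∘ perm w) q₀≡i)) M′<M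

    open Exchange w w-inj false {q₀} {i} q₀≢i

    t : Trans D n
    t = pos a b (q₀≢i ∘ w-inj)

    cost-away : ∀ {k} → k ≢ M → cost k ≡ 0
    cost-away {k} k≢M = cong 𝟙 (trans (cong (_xor low k b) a∼b) (xor-same (low k b)))
      where
      a∼b : low k a ≡ low k b
      a∼b rewrite value-q₀ = ≡-by-⇔
        (λ M′<k → <ᵇ-true {n = k} (≤∧≢⇒< (subst (_≤ k) suc-M′ (<ᵇ-true⁻¹ M′<k)) (k≢M ∘ sym)))
        (λ M<k → <ᵇ-true {n = k} (<-trans M′<M (<ᵇ-true⁻¹ M<k)))

    a-low : low M a ≡ true
    a-low = trans (cong (_<ᵇ M) value-q₀) (<ᵇ-true M′<M)

    b-high : low M b ≡ false
    b-high = <ᵇ-false {M} ≤-refl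

    q₀-low : low M q₀ ≡ true
    q₀-low = trans (closed-at-M q₀) a-low

    weight-at-M : weight D M u′ + 2 * cost M ≤ weight D M w
    weight-at-M = begin
      level M u′ + 2 * oddBlock M u′ + 2 * cost M ≡⟨ cong₂ (λ o c → level M u′ + 2 * o + 2 * c) odd-after cost-M ⟩
      level M u′ + 0 + 2                          ≡⟨ cong (_+ 2) (+-identityʳ _) ⟩
      level M u′ + 2                              ≤⟨ +-monoˡ-≤ 2 level-at-M ⟩
      level M w + 0 + 2                           ≡⟨ cong (_+ 2) (+-identityʳ _) ⟩
      level M w + 2                               ≡⟨ cong (λ o → level M w + 2 * o) (sym odd-before) ⟩
      level M w + 2 * oddBlock M w                ∎
      where
      open ≤-Reasoning
      cost-M : cost M ≡ 1
      cost-M rewrite a-low | b-high = refl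
      odd-before : oddBlock M w ≡ 1
      odd-before rewrite Closed⇒closedB w w-inj M closed-at-M | odd-below-M = refl
      odd-after : oddBlock M u′ ≡ 0
      odd-after = oddBlock≡0 u′ M λ closed _ → true≢false (trans (sym q₀-low)
                    (trans (closedB⇒Closed u′ u′-injective M closed q₀) (trans (cong (low M) perm-p) b-high)))
      level-at-M : level M u′ ≤ level M w + 0
      level-at-M = level-≤ M (exchange-at-block-end (low M q₀) (low M i) (low M a) (low M b) (neg w q₀) (neg w i)
        (⊑-reflexive (sym q₀-low)) (⊑-reflexive (sym a-low)) (⊑-reflexive b-high)
        (⊑-reflexive (<ᵇ-false {I} M≤I)) (⊑-reflexive (sym i-negative)))

    improvement : Improvement D w
    improvement = t , potential-tight t w tight , group-kept D (λ ()) w∈D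
      where
      tight : ∀ k → weight D k u′ + 2 * cost k ≤ weight D k w
      tight k with k ≟ M
      ... | yes refl = weight-at-M
      ... | no  k≢M  = begin
        weight D k u′ + 2 * cost k   ≡⟨ cong (λ c → weight D k u′ + 2 * c) (cost-away k≢M) ⟩
        weight D k u′ + 0            ≡⟨ +-identityʳ _ ⟩
        weight D k u′                ≤⟨ weight-D-bound k ⟩
        weight D k w + 2 * cost k    ≡⟨ cong (λ c → weight D k w + 2 * c) (cost-away k≢M) ⟩
        weight D k w + 0             ≡⟨ +-identityʳ _ ⟩
        weight D k w                 ∎
        where open ≤-Reasoning

  improvement : Improvement D w
  improvement with max-search candidate?
  ... | inj₁ none = NoCandidate.improvement none
  ... | inj₂ (q , (M≤q , q<I , inj₁ negative) , last) = exchange-negative M≤q q<I negative last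
  ... | inj₂ (q , (M≤q , q<I , inj₂ A<M) , last) with neg w q Bool.≟ true
  ...   | yes negative = exchange-negative M≤q q<I negative last
  ...   | no  positive = exchange-below M≤q q<I (¬-not positive) A<M

-- Upper bound

improve : ∀ X {n} (w : SPerm n) → InGroup X w → Injective _≡_ _≡_ (perm w) → w ≈ idSP ⊎ Improvement X w
improve X w w∈X w-inj with max-search (λ x → ¬? (fixed? w x))
... | inj₁ all-fixed = inj₁ (all-fixed⇒id w (λ x → decidable-stable (fixed? w x) (all-fixed x)))
... | inj₂ (i , i-moved , fixed-above) = inj₂ (by-sign X w∈X (neg w i) refl)
  where
  fixed-above′ : ∀ y → toℕ i < toℕ y → Fixed w y
  fixed-above′ y i<y = decidable-stable (fixed? w y) (fixed-above y i<y)
  by-sign : ∀ X → InGroup X w → ∀ ν → neg w i ≡ ν → Improvement X w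
  by-sign X w∈X false i-positive = ImprovePositive.improvement w w∈X w-inj i i-moved fixed-above′ i-positive
  by-sign A w∈A true  i-negative = ⊥-elim (true≢false (trans (sym i-negative) (w∈A i)))
  by-sign B _   true  i-negative = ImproveNegativeB.improvement w w-inj i i-moved fixed-above′ i-negative
  by-sign D w∈D true  i-negative = ImproveNegativeD.improvement w w∈D w-inj i i-moved fixed-above′ i-negative

tcost-positive : ∀ {X n} (t : Trans X n) → 1 ≤ tcost t
tcost-positive (pos i j i≢j) = n≢0⇒n>0 (i≢j ∘ toℕ-injective ∘ ∣m-n∣≡0⇒m≡n)
tcost-positive (ngt _ i j _) = s≤s z≤n
tcost-positive (flp i)       = s≤s z≤n

val-cong : ∀ {n} (u v : SPerm n) x → perm u x ≡ perm v x → neg u x ≡ neg v x → val u x ≡ val v x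
val-cong u v x same-perm same-neg rewrite same-perm | same-neg = refl

∘SP-congʳ : ∀ {n} (s : SPerm n) {u v : SPerm n} → u ≈ v → (s ∘SP u) ≈ (s ∘SP v)
∘SP-congʳ s {u} {v} u≈v x with val-injective u v x (u≈v x)
... | same-perm , same-neg = val-cong (s ∘SP u) (s ∘SP v) x (cong (perm s) same-perm)
                                      (cong₂ (λ ν y → ν xor neg s y) same-neg same-perm)

xor-xor-cancelʳ : ∀ a b → (a xor b) xor b ≡ a
xor-xor-cancelʳ a b = trans (xor-assoc a b b) (trans (cong (a xor_) (xor-same b)) (xor-identityʳ a))

⟦⟧-involutive : ∀ {X n} (t : Trans X n) (w : SPerm n) → (⟦ t ⟧ ∘SP (⟦ t ⟧ ∘SP w)) ≈ w
⟦⟧-involutive t@(pos i j _) w x =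
  val-cong (⟦ t ⟧ ∘SP (⟦ t ⟧ ∘SP w)) w x (swapFin-involutive i j (perm w x)) (xor-xor-cancelʳ (neg w x) false)
⟦⟧-involutive t@(ngt _ i j _) w x =
  val-cong (⟦ t ⟧ ∘SP (⟦ t ⟧ ∘SP w)) w x (swapFin-involutive i j (perm w x))
    (trans (cong ((neg w x xor τ (perm w x)) xor_) (τ-swapFin (perm w x))) (xor-xor-cancelʳ (neg w x) (τ (perm w x))))
  where
  τ : _ → Bool
  τ y = (toℕ y ≡ᵇ toℕ i) ∨ (toℕ y ≡ᵇ toℕ j)
  τ-swapFin : ∀ y → τ (swapFin i j y) ≡ τ y
  τ-swapFin y with y Fin.≟ i | y Fin.≟ j
  ... | yes refl | _        rewrite swapFin-matchˡ y j | ≡ᵇ-refl (toℕ j) | ≡ᵇ-refl (toℕ y) = trans (∨-zeroʳ _) refl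
  ... | no _     | yes refl rewrite swapFin-matchʳ i y | ≡ᵇ-refl (toℕ i) | ≡ᵇ-refl (toℕ y) = sym (∨-zeroʳ _)
  ... | no y≢i   | no y≢j   rewrite swapFin-mismatch i j y y≢i y≢j = refl
⟦⟧-involutive t@(flp i) w x =
  val-cong (⟦ t ⟧ ∘SP (⟦ t ⟧ ∘SP w)) w x refl (xor-xor-cancelʳ (neg w x) (toℕ (perm w x) ≡ᵇ toℕ i))

upper-bound : ∀ X {n} (w : SPerm n) → InGroup X w → Injective _≡_ _≡_ (perm w) →
              Σ (List (Trans X n)) λ ts → prod ts ≈ w × 2 * totalCost ts ≤ potential X w
upper-bound X w w∈X w-inj = go w w∈X w-inj (<-wellFounded (potential X w))
  where
  go : ∀ {n} (w : SPerm n) → InGroup X w → Injective _≡_ _≡_ (perm w) → Acc _<_ (potential X w) →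
       Σ (List (Trans X n)) λ ts → prod ts ≈ w × 2 * totalCost ts ≤ potential X w
  go w w∈X w-inj (acc smaller) with improve X w w∈X w-inj
  ... | inj₁ w≈id = [] , (λ x → sym (w≈id x)) , z≤n
  ... | inj₂ (t , improves , tw∈X) with go (⟦ t ⟧ ∘SP w) tw∈X (w-inj ∘ ⟦⟧-injective t) (smaller decreases)
    where
    decreases : potential X (⟦ t ⟧ ∘SP w) < potential X w
    decreases = <-≤-trans (m<m+n _ (≤-trans (s≤s z≤n) (*-monoʳ-≤ 2 (tcost-positive t)))) improves
  ...   | ts , ts≈tw , cost≤ = t ∷ ts , (λ x → trans (∘SP-congʳ ⟦ t ⟧ ts≈tw x) (⟦⟧-involutive t w x)) , (begin
    2 * (tcost t + totalCost ts)                 ≡⟨ *-distribˡ-+ 2 (tcost t) (totalCost ts) ⟩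
    2 * tcost t + 2 * totalCost ts               ≤⟨ +-monoʳ-≤ (2 * tcost t) cost≤ ⟩
    2 * tcost t + potential X (⟦ t ⟧ ∘SP w)      ≡⟨ +-comm (2 * tcost t) _ ⟩
    potential X (⟦ t ⟧ ∘SP w) + 2 * tcost t      ≤⟨ improves ⟩
    potential X w                                ∎)
    where open ≤-Reasoning

theorem3p7 : (X : Kind) (n : ℕ) (w : SPerm n) → Injective _≡_ _≡_ (perm w) → InGroup X w →
    Σ ℕ (λ c → IsMinCost X w c × (2 * c + 2 * bl X w ≡ tvd w + 2 * blB w))
theorem3p7 X n w w-inj w∈X with upper-bound X w w∈X w-inj
... | ts , ts≈w , cost≤potential = totalCost ts , ((ts , ts≈w , refl) , minimal) , identity
  where
  minimal : ∀ ts′ → prod ts′ ≈ w → totalCost ts ≤ totalCost ts′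
  minimal ts′ ts′≈w = *-cancelˡ-≤ 2 (≤-trans cost≤potential (lower-bound w w-inj ts′ ts′≈w))
  identity : 2 * totalCost ts + 2 * bl X w ≡ tvd w + 2 * blB w
  identity = trans (cong (_+ 2 * bl X w) (≤-antisym cost≤potential (lower-bound w w-inj ts ts≈w)))
                   (potential-blocks X w w∈X)
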